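{- Let $p>10$ and $\ell$ be integers with $0<\ell<\frac p2$, and define $(c_t)_{t\ge0}$ by \[ \frac{Q(q^{\ell},q^{p})}{(q;q)_\infty}=\sum_{t=0}^{\infty}c_tq^t . \] Then there is $t_0=t_0(\ell)$ such that $c_t>0$ for all $t>t_0$.
   Context: For complex $z\neq0$ and $0<|q|<1$: $(z;q)_\infty=\prod_{j\ge0}(1-zq^j)$, $(a_1,\dots,a_j;q)_\infty=\prod_i(a_i;q)_\infty$, and the quintuple product is $Q(z,q)=(z,q/z,q;q)_\infty(qz^2,q/z^2;q^2)_\infty$. -}

module Defs where

open import Data.Nat as ℕ using (ℕ; zero; suc; _∸_; _≟_)
open import Data.Integer as ℤ using (ℤ; 0ℤ; 1ℤ; _-_)
open import Relation.Nullary using (yes; no)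

-- Formal power series in q with integer coefficients: n ↦ coefficient of q^n.
PS : Set
PS = ℕ → ℤ

sumTo : ℕ → (ℕ → ℤ) → ℤ
sumTo zero    f = f 0
sumTo (suc n) f = sumTo n f ℤ.+ f (suc n)

infixl 7 _⊛_
_⊛_ : PS → PS → PS
(f ⊛ g) n = sumTo n (λ k → f k ℤ.* g (n ∸ k))

one : PS
one zero    = 1ℤ
one (suc _) = 0ℤ

mono : ℕ → PS
mono e n with n ≟ e
... | yes _ = 1ℤ
... | no  _ = 0ℤ

oneMinus : ℕ → PS
oneMinus e n = one n - mono e n

partialPoch : ℕ → ℕ → ℕ → PS
partialPoch a b zero    = one
partialPoch a b (suc m) = partialPoch a b m ⊛ oneMinus (a ℕ.+ b ℕ.* m)

-- (q^a ; q^b)_∞ as a formal power series, for a ≥ 1, b ≥ 1.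
-- The coefficient of q^n of the infinite product equals that of the partial
-- product over j ≤ n, since every later factor is 1 - q^e with e > n.
poch : ℕ → ℕ → PS
poch a b n = partialPoch a b (suc n) n

-- Q(q^ℓ, q^p) = (q^ℓ, q^(p-ℓ), q^p ; q^p)_∞ (q^(p+2ℓ), q^(p-2ℓ) ; q^(2p))_∞
-- (meaningful for 0 < ℓ < p/2, where all exponents are positive)
quintuple : ℕ → ℕ → PS
quintuple ℓ p =
  poch ℓ p ⊛ poch (p ∸ ℓ) p ⊛ poch p p
    ⊛ poch (p ℕ.+ 2 ℕ.* ℓ) (2 ℕ.* p) ⊛ poch (p ∸ 2 ℕ.* ℓ) (2 ℕ.* p)

qPoch : PS
qPoch = poch 1 1

-- Truncated at degree N, each Pochhammer factor (q^a; q^b)_∞ of Q(q^ℓ, q^p) is the product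
-- of 1 - q^e over its exponents e = a + b j, and (q;q)_∞ is ∏_{k ≤ N} (1 - q^k).  When the
-- numerator exponents are pairwise distinct, the quotient is ∏ 1/(1 - q^k) over the parts k
-- they do not use, a series with nonnegative coefficients; if the unused parts contain 1, or
-- 2 and an odd s ≤ N, its coefficient of q^N is positive.
--
-- For p ≢ 3ℓ the five exponent families lie in distinct residue classes, and 1 or both of 2
-- and 3 are unused.
-- For p = 3ℓ the exponents of B₁, B₂ repeat those of A₂, A₁.  There each 1 - q^(b+c) of B is
-- written as (1 - q^b)(1 - q^c) times (1 - q^(b+c)) / ((1 - q^b)(1 - q^c)) = 1/(1 - q^c) +
-- q^b/(1 - q^b), which has nonnegative coefficients, with b and c in unused residue classes.  Hence t₀ = 2ℓ works.
module Submission where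

open import Defs
open import Algebra.Bundles using (CommutativeMonoid)
import Algebra.Solver.CommutativeMonoid as CMSolver
open import Data.Empty using (⊥; ⊥-elim)
open import Data.Integer as ℤ using (ℤ; 0ℤ; 1ℤ) renaming (_≤_ to _≤ℤ_; _<_ to _<ℤ_)
import Data.Integer.Properties as ℤP
open import Algebra.Properties.AbelianGroup ℤP.+-0-abelianGroup using (∙-cancelˡ)
open import Data.Integer.Tactic.RingSolver using (solve-∀)
open import Data.List using (List; []; _∷_; _++_; concat; map; applyDownFrom; downFrom)
open import Data.List.Membership.Propositional using (_∉_)
open import Data.List.Membership.Propositional.Properties using (∈-concat⁻)
open import Data.List.Relation.Binary.Disjoint.Propositional using (Disjoint)
open import Data.List.Relation.Binary.Pointwise using (Pointwise; []; _∷_)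
open import Data.List.Relation.Unary.All as All using (All; []; _∷_; lookup)
import Data.List.Relation.Unary.All.Properties as Allₚ
open import Data.List.Relation.Unary.AllPairs as AllPairs using (AllPairs; []; _∷_)
open import Data.List.Relation.Unary.Any using (here; there)
open import Data.List.Relation.Unary.Linked using (Linked; [-]; _∷_)
open import Data.List.Relation.Unary.Linked.Properties using (Linked⇒AllPairs)
open import Data.List.Relation.Unary.Unique.Propositional using (Unique)
import Data.List.Relation.Unary.Unique.Propositional.Properties as Uniqueₚ
open import Data.Nat using (ℕ; zero; suc; _+_; _*_; _∸_; _≤_; _<_; _>_; z≤n; s≤s; _≟_; NonZero; >-nonZero)
open import Data.Nat.DivMod using (_%_; m<n⇒m%n≡m; [m+kn]%n≡m%n; [m+n]%n≡m%n; n%n≡0)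
open import Data.Nat.Divisibility using (_∣_; _∤_; _∣?_; divides; _∣0; ∣-refl; ∣m+n∣m⇒∣n; ∣m∸n∣n⇒∣m; >⇒∤)
open import Data.Nat.ListAction using (sum)
open import Data.Nat.Properties
  using ( _≤?_; ≤-refl; ≤-reflexive; ≤-trans; ≤-pred; <-trans; <-≤-trans; ≤-<-trans
        ; <⇒≤; <⇒≢; >⇒≢; <⇒≱; ≮⇒≥; ≰⇒>
        ; n<1+n; n≤1+n; m≤n⇒m≤1+n; m≤n⇒m<n∨m≡n; m≤m+n; m<m+n; m<n+m
        ; +-assoc; +-comm; +-identityʳ; +-suc; +-cancelˡ-≡; +-cancelʳ-<; +-mono-≤; +-monoˡ-≤; +-monoʳ-<
        ; *-assoc; *-comm; *-identityˡ; *-identityʳ; *-suc; *-cancelˡ-≡; *-monoˡ-≤; *-monoʳ-≤; *-distribˡ-∸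
        ; n∸n≡0; m∸n≤m; m+n∸m≡n; m+n∸n≡m; m∸n+n≡m; m+[n∸m]≡n; m∸[m∸n]≡n; m<n⇒0<n∸m
        ; +-∸-assoc; ∸-+-assoc
        ; ∸-cancelˡ-≡; ∸-monoʳ-<; ∸-monoʳ-≤ )
import Data.Nat.Tactic.RingSolver as ℕ-Solver
open import Data.Product using (_×_; _,_; proj₁; proj₂; ∃-syntax)
open import Data.Sum using (_⊎_; inj₁; inj₂)
open import Function using (_∘_)
open import Relation.Binary.Bundles using (Setoid)
open import Relation.Binary.PropositionalEquality
import Relation.Binary.Reasoning.Setoid as SetoidReasoning
open import Relation.Nullary using (yes; no)

-- Finite sums

sumTo-cong : ∀ n {f g : ℕ → ℤ} → (∀ i → i ≤ n → f i ≡ g i) → sumTo n f ≡ sumTo n g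
sumTo-cong zero    f≗g = f≗g 0 z≤n
sumTo-cong (suc n) f≗g =
  cong₂ ℤ._+_ (sumTo-cong n (λ i i≤n → f≗g i (m≤n⇒m≤1+n i≤n))) (f≗g (suc n) ≤-refl)

sumTo-distrib-+ : ∀ n f g → sumTo n (λ i → f i ℤ.+ g i) ≡ sumTo n f ℤ.+ sumTo n g
sumTo-distrib-+ zero    f g = refl
sumTo-distrib-+ (suc n) f g = begin
  sumTo n (λ i → f i ℤ.+ g i) ℤ.+ (f (suc n) ℤ.+ g (suc n))
    ≡⟨ cong (ℤ._+ (f (suc n) ℤ.+ g (suc n))) (sumTo-distrib-+ n f g) ⟩
  (sumTo n f ℤ.+ sumTo n g) ℤ.+ (f (suc n) ℤ.+ g (suc n))
    ≡⟨ interchange (sumTo n f) (sumTo n g) (f (suc n)) (g (suc n)) ⟩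
  (sumTo n f ℤ.+ f (suc n)) ℤ.+ (sumTo n g ℤ.+ g (suc n)) ∎
  where
  open ≡-Reasoning
  interchange : ∀ a b c d → (a ℤ.+ b) ℤ.+ (c ℤ.+ d) ≡ (a ℤ.+ c) ℤ.+ (b ℤ.+ d)
  interchange = solve-∀

sumTo-distrib-- : ∀ n f g → sumTo n (λ i → f i ℤ.- g i) ≡ sumTo n f ℤ.- sumTo n g
sumTo-distrib-- zero    f g = refl
sumTo-distrib-- (suc n) f g = begin
  sumTo n (λ i → f i ℤ.- g i) ℤ.+ (f (suc n) ℤ.- g (suc n))
    ≡⟨ cong (ℤ._+ (f (suc n) ℤ.- g (suc n))) (sumTo-distrib-- n f g) ⟩
  (sumTo n f ℤ.- sumTo n g) ℤ.+ (f (suc n) ℤ.- g (suc n))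
    ≡⟨ interchange (sumTo n f) (sumTo n g) (f (suc n)) (g (suc n)) ⟩
  (sumTo n f ℤ.+ f (suc n)) ℤ.- (sumTo n g ℤ.+ g (suc n)) ∎
  where
  open ≡-Reasoning
  interchange : ∀ a b c d → (a ℤ.- b) ℤ.+ (c ℤ.- d) ≡ (a ℤ.+ c) ℤ.- (b ℤ.+ d)
  interchange = solve-∀

sumTo-*ˡ : ∀ n a f → sumTo n (λ i → a ℤ.* f i) ≡ a ℤ.* sumTo n f
sumTo-*ˡ zero    a f = refl
sumTo-*ˡ (suc n) a f =
  trans (cong (ℤ._+ (a ℤ.* f (suc n))) (sumTo-*ˡ n a f)) (sym (ℤP.*-distribˡ-+ a (sumTo n f) (f (suc n))))

sumTo-*ʳ : ∀ n a f → sumTo n (λ i → f i ℤ.* a) ≡ sumTo n f ℤ.* a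
sumTo-*ʳ zero    a f = refl
sumTo-*ʳ (suc n) a f =
  trans (cong (ℤ._+ (f (suc n) ℤ.* a)) (sumTo-*ʳ n a f)) (sym (ℤP.*-distribʳ-+ a (sumTo n f) (f (suc n))))

sumTo-unfoldˡ : ∀ n f → sumTo (suc n) f ≡ f 0 ℤ.+ sumTo n (λ i → f (suc i))
sumTo-unfoldˡ zero    f = refl
sumTo-unfoldˡ (suc n) f =
  trans (cong (ℤ._+ f (suc (suc n))) (sumTo-unfoldˡ n f)) (ℤP.+-assoc (f 0) _ _)

sumTo-reverse : ∀ n f → sumTo n f ≡ sumTo n (λ i → f (n ∸ i))
sumTo-reverse zero    f = refl
sumTo-reverse (suc n) f = begin
  sumTo n f ℤ.+ f (suc n)                   ≡⟨ cong (ℤ._+ f (suc n)) (sumTo-reverse n f) ⟩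
  sumTo n (λ i → f (n ∸ i)) ℤ.+ f (suc n)   ≡⟨ ℤP.+-comm _ (f (suc n)) ⟩
  f (suc n) ℤ.+ sumTo n (λ i → f (n ∸ i))   ≡⟨ sumTo-unfoldˡ n (λ i → f (suc n ∸ i)) ⟨
  sumTo (suc n) (λ i → f (suc n ∸ i))       ∎
  where open ≡-Reasoning

sumTo-triangle : ∀ n (F : ℕ → ℕ → ℤ) →
  sumTo n (λ k → sumTo k (λ i → F i k)) ≡ sumTo n (λ i → sumTo (n ∸ i) (λ j → F i (i + j)))
sumTo-triangle zero    F = refl
sumTo-triangle (suc n) F = begin
  sumTo n (λ k → sumTo k (λ i → F i k)) ℤ.+ (sumTo n (λ i → F i (suc n)) ℤ.+ F (suc n) (suc n))
    ≡⟨ cong (ℤ._+ (sumTo n (λ i → F i (suc n)) ℤ.+ F (suc n) (suc n))) (sumTo-triangle n F) ⟩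
  Rows n ℤ.+ (sumTo n (λ i → F i (suc n)) ℤ.+ F (suc n) (suc n))
    ≡⟨ ℤP.+-assoc (Rows n) _ _ ⟨
  (Rows n ℤ.+ sumTo n (λ i → F i (suc n))) ℤ.+ F (suc n) (suc n)
    ≡⟨ cong (ℤ._+ F (suc n) (suc n)) (sumTo-distrib-+ n _ _) ⟨
  sumTo n (λ i → sumTo (n ∸ i) (λ j → F i (i + j)) ℤ.+ F i (suc n)) ℤ.+ F (suc n) (suc n)
    ≡⟨ cong₂ ℤ._+_ (sumTo-cong n extendRow) lastRow ⟩
  sumTo (suc n) (λ i → sumTo (suc n ∸ i) (λ j → F i (i + j))) ∎
  where
  open ≡-Reasoning
  Rows : ℕ → ℤ
  Rows m = sumTo m (λ i → sumTo (m ∸ i) (λ j → F i (i + j)))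
  lastRow : F (suc n) (suc n) ≡ sumTo (n ∸ n) (λ j → F (suc n) (suc n + j))
  lastRow rewrite n∸n≡0 n = cong (F (suc n)) (sym (+-identityʳ (suc n)))
  extendRow : ∀ i → i ≤ n →
    sumTo (n ∸ i) (λ j → F i (i + j)) ℤ.+ F i (suc n) ≡ sumTo (suc n ∸ i) (λ j → F i (i + j))
  extendRow i i≤n rewrite +-∸-assoc 1 i≤n =
    cong (λ m → sumTo (n ∸ i) (λ j → F i (i + j)) ℤ.+ F i m)
      (trans (cong suc (sym (m+[n∸m]≡n i≤n))) (sym (+-suc i (n ∸ i))))

sumTo-supportedAbove : ∀ n e (f : ℕ → ℤ) → (∀ k → k ≢ e → f k ≡ 0ℤ) → n < e → sumTo n f ≡ 0ℤ
sumTo-supportedAbove zero    e f vanish (s≤s _) = vanish 0 (λ ())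
sumTo-supportedAbove (suc n) e f vanish n<e =
  cong₂ ℤ._+_ (sumTo-supportedAbove n e f vanish (<-trans (n<1+n n) n<e)) (vanish (suc n) (<⇒≢ n<e))

sumTo-supportedAt : ∀ n e (f : ℕ → ℤ) → (∀ k → k ≢ e → f k ≡ 0ℤ) → e ≤ n → sumTo n f ≡ f e
sumTo-supportedAt zero    .zero f vanish z≤n = refl
sumTo-supportedAt (suc n) e     f vanish e≤1+n with m≤n⇒m<n∨m≡n e≤1+n
... | inj₁ e<1+n = trans (cong₂ ℤ._+_ (sumTo-supportedAt n e f vanish (≤-pred e<1+n)) (vanish (suc n) (>⇒≢ e<1+n)))
                         (ℤP.+-identityʳ (f e))
... | inj₂ refl  = trans (cong (ℤ._+ f (suc n)) (sumTo-supportedAbove n (suc n) f vanish ≤-refl))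
                         (ℤP.+-identityˡ _)

-- Power series

infix 4 _≐_
record _≐_ (f g : PS) : Set where
  constructor mk≐
  field coeff : ∀ n → f n ≡ g n
open _≐_ public

≐-refl : ∀ {f} → f ≐ f
≐-refl = mk≐ λ _ → refl

≡⇒≐ : ∀ {f g} → f ≡ g → f ≐ g
≡⇒≐ refl = ≐-refl

≐-sym : ∀ {f g} → f ≐ g → g ≐ f
≐-sym f≐g = mk≐ λ n → sym (coeff f≐g n)

≐-trans : ∀ {f g h} → f ≐ g → g ≐ h → f ≐ h
≐-trans f≐g g≐h = mk≐ λ n → trans (coeff f≐g n) (coeff g≐h n)

infix 4 _≈[_]_
record _≈[_]_ (f : PS) (N : ℕ) (g : PS) : Set where
  constructor mk≈
  field coeff≤ : ∀ n → n ≤ N → f n ≡ g n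
open _≈[_]_ public

≈-refl : ∀ {f N} → f ≈[ N ] f
≈-refl = mk≈ λ _ _ → refl

≈-sym : ∀ {f g N} → f ≈[ N ] g → g ≈[ N ] f
≈-sym f≈g = mk≈ λ n n≤N → sym (coeff≤ f≈g n n≤N)

≈-trans : ∀ {f g h N} → f ≈[ N ] g → g ≈[ N ] h → f ≈[ N ] h
≈-trans f≈g g≈h = mk≈ λ n n≤N → trans (coeff≤ f≈g n n≤N) (coeff≤ g≈h n n≤N)

≈-setoid : ℕ → Setoid _ _
≈-setoid N = record
  { Carrier = PS ; _≈_ = _≈[ N ]_
  ; isEquivalence = record { refl = ≈-refl ; sym = ≈-sym ; trans = ≈-trans } }

module ≈-Reasoning (N : ℕ) = SetoidReasoning (≈-setoid N)

≐⇒≈ : ∀ {f g} N → f ≐ g → f ≈[ N ] g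
≐⇒≈ N f≐g = mk≈ λ n _ → coeff f≐g n

⊛-cong : ∀ {f f′ g g′} → f ≐ f′ → g ≐ g′ → f ⊛ g ≐ f′ ⊛ g′
⊛-cong f≐f′ g≐g′ = mk≐ λ n → sumTo-cong n λ i _ → cong₂ ℤ._*_ (coeff f≐f′ i) (coeff g≐g′ (n ∸ i))

⊛-congˡ : ∀ {f f′} g → f ≐ f′ → f ⊛ g ≐ f′ ⊛ g
⊛-congˡ g f≐f′ = ⊛-cong f≐f′ (≐-refl {g})

⊛-congʳ : ∀ f {g g′} → g ≐ g′ → f ⊛ g ≐ f ⊛ g′
⊛-congʳ f g≐g′ = ⊛-cong (≐-refl {f}) g≐g′

⊛-cong-≈ : ∀ {f f′ g g′ N} → f ≈[ N ] f′ → g ≈[ N ] g′ → f ⊛ g ≈[ N ] f′ ⊛ g′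
⊛-cong-≈ f≈f′ g≈g′ = mk≈ λ n n≤N → sumTo-cong n λ i i≤n →
  cong₂ ℤ._*_ (coeff≤ f≈f′ i (≤-trans i≤n n≤N)) (coeff≤ g≈g′ (n ∸ i) (≤-trans (m∸n≤m n i) n≤N))

⊛-comm : ∀ f g → f ⊛ g ≐ g ⊛ f
⊛-comm f g = mk≐ λ n → trans (sumTo-reverse n _) (sumTo-cong n λ i i≤n →
  trans (ℤP.*-comm (f (n ∸ i)) _) (cong (λ m → g m ℤ.* f (n ∸ i)) (m∸[m∸n]≡n i≤n)))

⊛-assoc : ∀ f g h → (f ⊛ g) ⊛ h ≐ f ⊛ (g ⊛ h)
⊛-assoc f g h = mk≐ λ n → begin
  sumTo n (λ k → sumTo k (λ i → f i ℤ.* g (k ∸ i)) ℤ.* h (n ∸ k))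
    ≡⟨ sumTo-cong n (λ k _ → sym (sumTo-*ʳ k (h (n ∸ k)) _)) ⟩
  sumTo n (λ k → sumTo k (λ i → f i ℤ.* g (k ∸ i) ℤ.* h (n ∸ k)))
    ≡⟨ sumTo-triangle n (λ i k → f i ℤ.* g (k ∸ i) ℤ.* h (n ∸ k)) ⟩
  sumTo n (λ i → sumTo (n ∸ i) (λ j → f i ℤ.* g (i + j ∸ i) ℤ.* h (n ∸ (i + j))))
    ≡⟨ sumTo-cong n (λ i _ → sumTo-cong (n ∸ i) (λ j _ → reindex n i j)) ⟩
  sumTo n (λ i → sumTo (n ∸ i) (λ j → f i ℤ.* (g j ℤ.* h (n ∸ i ∸ j))))
    ≡⟨ sumTo-cong n (λ i _ → sumTo-*ˡ (n ∸ i) (f i) _) ⟩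
  sumTo n (λ i → f i ℤ.* sumTo (n ∸ i) (λ j → g j ℤ.* h (n ∸ i ∸ j))) ∎
  where
  open ≡-Reasoning
  reindex : ∀ n i j → f i ℤ.* g (i + j ∸ i) ℤ.* h (n ∸ (i + j)) ≡ f i ℤ.* (g j ℤ.* h (n ∸ i ∸ j))
  reindex n i j = trans (ℤP.*-assoc (f i) _ _)
    (cong₂ (λ a b → f i ℤ.* (g a ℤ.* h b)) (m+n∸m≡n i j) (sym (∸-+-assoc n i j)))

mono-self : ∀ e → mono e e ≡ 1ℤ
mono-self e with e ≟ e
... | yes _  = refl
... | no e≢e = ⊥-elim (e≢e refl)

mono-≢ : ∀ e n → n ≢ e → mono e n ≡ 0ℤ
mono-≢ e n n≢e with n ≟ e
... | yes n≡e = ⊥-elim (n≢e n≡e)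
... | no _    = refl

mono-⊛-≤ : ∀ e f n → e ≤ n → (mono e ⊛ f) n ≡ f (n ∸ e)
mono-⊛-≤ e f n e≤n =
  trans (sumTo-supportedAt n e _ (λ k k≢e → cong (ℤ._* f (n ∸ k)) (mono-≢ e k k≢e)) e≤n)
        (trans (cong (ℤ._* f (n ∸ e)) (mono-self e)) (ℤP.*-identityˡ _))

mono-⊛-> : ∀ e f n → n < e → (mono e ⊛ f) n ≡ 0ℤ
mono-⊛-> e f n n<e = sumTo-supportedAbove n e _ (λ k k≢e → cong (ℤ._* f (n ∸ k)) (mono-≢ e k k≢e)) n<e

one≐mono0 : one ≐ mono 0
one≐mono0 = mk≐ λ { zero → refl ; (suc n) → refl }

⊛-identityˡ : ∀ f → one ⊛ f ≐ f
⊛-identityˡ f = mk≐ λ n → trans (coeff (⊛-congˡ f one≐mono0) n) (mono-⊛-≤ 0 f n z≤n)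

⊛-identityʳ : ∀ f → f ⊛ one ≐ f
⊛-identityʳ f = ≐-trans (⊛-comm f one) (⊛-identityˡ f)

⊛-commutativeMonoid : CommutativeMonoid _ _
⊛-commutativeMonoid = record
  { Carrier = PS ; _≈_ = _≐_ ; _∙_ = _⊛_ ; ε = one
  ; isCommutativeMonoid = record
    { isMonoid = record
      { isSemigroup = record
        { isMagma = record
          { isEquivalence = record { refl = ≐-refl ; sym = ≐-sym ; trans = ≐-trans }
          ; ∙-cong = ⊛-cong }
        ; assoc = ⊛-assoc }
      ; identity = ⊛-identityˡ , ⊛-identityʳ }
    ; comm = ⊛-comm } }

open CMSolver ⊛-commutativeMonoid using (solve; _⊜_; _⊕_; id)
module ≐-Reasoning = SetoidReasoning (CommutativeMonoid.setoid ⊛-commutativeMonoid)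

⊛-interchange : ∀ a b c d → (a ⊛ b) ⊛ (c ⊛ d) ≐ (a ⊛ c) ⊛ (b ⊛ d)
⊛-interchange = solve 4 (λ a b c d → (a ⊕ b) ⊕ (c ⊕ d) ⊜ (a ⊕ c) ⊕ (b ⊕ d)) ≐-refl

infixl 6 _+ₛ_
_+ₛ_ : PS → PS → PS
(f +ₛ g) n = f n ℤ.+ g n

+ₛ-cong : ∀ {f f′ g g′} → f ≐ f′ → g ≐ g′ → f +ₛ g ≐ f′ +ₛ g′
+ₛ-cong f≐f′ g≐g′ = mk≐ λ n → cong₂ ℤ._+_ (coeff f≐f′ n) (coeff g≐g′ n)

⊛-distribʳ-+ₛ : ∀ f g h → (f +ₛ g) ⊛ h ≐ f ⊛ h +ₛ g ⊛ h
⊛-distribʳ-+ₛ f g h = mk≐ λ n →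
  trans (sumTo-cong n (λ i _ → ℤP.*-distribʳ-+ (h (n ∸ i)) (f i) (g i))) (sumTo-distrib-+ n _ _)

-- Geometric series

oneMinus-⊛ : ∀ e f n → (oneMinus e ⊛ f) n ≡ f n ℤ.- (mono e ⊛ f) n
oneMinus-⊛ e f n = begin
  sumTo n (λ k → (one k ℤ.- mono e k) ℤ.* f (n ∸ k))
    ≡⟨ sumTo-cong n (λ k _ → distrib (one k) (mono e k) (f (n ∸ k))) ⟩
  sumTo n (λ k → one k ℤ.* f (n ∸ k) ℤ.- mono e k ℤ.* f (n ∸ k))
    ≡⟨ sumTo-distrib-- n _ _ ⟩
  (one ⊛ f) n ℤ.- (mono e ⊛ f) n
    ≡⟨ cong (ℤ._- (mono e ⊛ f) n) (coeff (⊛-identityˡ f) n) ⟩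
  f n ℤ.- (mono e ⊛ f) n ∎
  where
  open ≡-Reasoning
  distrib : ∀ a b c → (a ℤ.- b) ℤ.* c ≡ a ℤ.* c ℤ.- b ℤ.* c
  distrib = solve-∀

-- the series 1 / (1 - q^e)
geom : ℕ → PS
geom e n with e ∣? n
... | yes _ = 1ℤ
... | no  _ = 0ℤ

geom-∣ : ∀ {e n} → e ∣ n → geom e n ≡ 1ℤ
geom-∣ {e} {n} e∣n with e ∣? n
... | yes _  = refl
... | no e∤n = ⊥-elim (e∤n e∣n)

geom-∤ : ∀ {e n} → e ∤ n → geom e n ≡ 0ℤ
geom-∤ {e} {n} e∤n with e ∣? n
... | yes e∣n = ⊥-elim (e∤n e∣n)
... | no _    = refl

geom-shift : ∀ {e n} → e ≤ n → geom e n ≡ geom e (n ∸ e)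
geom-shift {e} {n} e≤n with e ∣? n | e ∣? (n ∸ e)
... | yes _   | yes _     = refl
... | no _    | no _      = refl
... | yes e∣n | no e∤n∸e  = ⊥-elim (e∤n∸e (∣m+n∣m⇒∣n (subst (e ∣_) (sym (m+[n∸m]≡n e≤n)) e∣n) ∣-refl))
... | no e∤n  | yes e∣n∸e = ⊥-elim (e∤n (∣m∸n∣n⇒∣m e e≤n e∣n∸e ∣-refl))

oneMinus-geom-inverse : ∀ {e} → 1 ≤ e → oneMinus e ⊛ geom e ≐ one
oneMinus-geom-inverse {e} 1≤e = mk≐ λ n → trans (oneMinus-⊛ e (geom e) n) (telescope n)
  where
  telescope : ∀ n → geom e n ℤ.- (mono e ⊛ geom e) n ≡ one n
  telescope zero = cong₂ ℤ._-_ (geom-∣ (e ∣0)) (mono-⊛-> e (geom e) 0 1≤e)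
  telescope (suc n) with e ≤? suc n
  ... | yes e≤n = trans (cong₂ ℤ._-_ (geom-shift e≤n) (mono-⊛-≤ e (geom e) (suc n) e≤n))
                        (ℤP.+-inverseʳ (geom e (suc n ∸ e)))
  ... | no e≰n  = cong₂ ℤ._-_ (geom-∤ (>⇒∤ (≰⇒> e≰n))) (mono-⊛-> e (geom e) (suc n) (≰⇒> e≰n))

oneMinus-≈-one : ∀ {e N} → N < e → oneMinus e ≈[ N ] one
oneMinus-≈-one {e} N<e = mk≈ λ n n≤N →
  trans (cong (λ x → one n ℤ.- x) (mono-≢ e n (<⇒≢ (≤-<-trans n≤N N<e)))) (ℤP.+-identityʳ (one n))

geom-≈-one : ∀ {e N} → N < e → geom e ≈[ N ] one
geom-≈-one {e} N<e = mk≈ λ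
  { zero    _     → geom-∣ (e ∣0)
  ; (suc n) 1+n≤N → geom-∤ (>⇒∤ (≤-<-trans 1+n≤N N<e)) }

mono-shift : ∀ b c n → b ≤ n → mono c (n ∸ b) ≡ mono (b + c) n
mono-shift b c n b≤n with n ∸ b ≟ c | n ≟ b + c
... | yes _     | yes _     = refl
... | no _      | no _      = refl
... | yes n∸b≡c | no n≢b+c  = ⊥-elim (n≢b+c (trans (sym (m+[n∸m]≡n b≤n)) (cong (b +_) n∸b≡c)))
... | no n∸b≢c  | yes n≡b+c = ⊥-elim (n∸b≢c (trans (cong (_∸ b) n≡b+c) (m+n∸m≡n b c)))

oneMinus-+ : ∀ b c → oneMinus (b + c) ≐ oneMinus b +ₛ mono b ⊛ oneMinus c
oneMinus-+ b c = mk≐ split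
  where
  open ≡-Reasoning
  insert : ∀ x y z → x ℤ.- z ≡ (x ℤ.- y) ℤ.+ (y ℤ.- z)
  insert = solve-∀
  split : ∀ n → oneMinus (b + c) n ≡ oneMinus b n ℤ.+ (mono b ⊛ oneMinus c) n
  split n with b ≤? n
  ... | yes b≤n = begin
    one n ℤ.- mono (b + c) n
      ≡⟨ insert (one n) (mono b n) (mono (b + c) n) ⟩
    oneMinus b n ℤ.+ (mono b n ℤ.- mono (b + c) n)
      ≡⟨ cong (λ x → oneMinus b n ℤ.+ x) (cong₂ ℤ._-_ mono-b mono-b+c) ⟨
    oneMinus b n ℤ.+ oneMinus c (n ∸ b)
      ≡⟨ cong (λ x → oneMinus b n ℤ.+ x) (mono-⊛-≤ b (oneMinus c) n b≤n) ⟨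
    oneMinus b n ℤ.+ (mono b ⊛ oneMinus c) n ∎
    where
    mono-b : one (n ∸ b) ≡ mono b n
    mono-b = trans (coeff one≐mono0 (n ∸ b)) (trans (mono-shift b 0 n b≤n) (cong (λ e → mono e n) (+-identityʳ b)))
    mono-b+c : mono c (n ∸ b) ≡ mono (b + c) n
    mono-b+c = mono-shift b c n b≤n
  ... | no b≰n = begin
    one n ℤ.- mono (b + c) n
      ≡⟨ cong (λ x → one n ℤ.- x) (trans (mono-≢ (b + c) n (<⇒≢ (<-≤-trans n<b (m≤m+n b c))))
                                         (sym (mono-≢ b n (<⇒≢ n<b)))) ⟩
    oneMinus b n
      ≡⟨ ℤP.+-identityʳ (oneMinus b n) ⟨
    oneMinus b n ℤ.+ 0ℤ
      ≡⟨ cong (λ x → oneMinus b n ℤ.+ x) (mono-⊛-> b (oneMinus c) n n<b) ⟨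
    oneMinus b n ℤ.+ (mono b ⊛ oneMinus c) n ∎
    where
    n<b = ≰⇒> b≰n

-- Nonnegative coefficients

NonNeg : PS → Set
NonNeg f = ∀ n → 0ℤ ≤ℤ f n

NonNeg₁ : PS → Set
NonNeg₁ f = f 0 ≡ 1ℤ × NonNeg f

*-nonNeg : ∀ {a b} → 0ℤ ≤ℤ a → 0ℤ ≤ℤ b → 0ℤ ≤ℤ a ℤ.* b
*-nonNeg {ℤ.+ m} {ℤ.+ n} _ _ = subst (0ℤ ≤ℤ_) (ℤP.pos-* m n) (ℤ.+≤+ z≤n)

sumTo-nonNeg : ∀ n f → (∀ i → 0ℤ ≤ℤ f i) → 0ℤ ≤ℤ sumTo n f
sumTo-nonNeg zero    f f≥0 = f≥0 0
sumTo-nonNeg (suc n) f f≥0 = ℤP.+-mono-≤ (sumTo-nonNeg n f f≥0) (f≥0 (suc n))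

term-≤-sumTo : ∀ n f → (∀ i → 0ℤ ≤ℤ f i) → ∀ {i} → i ≤ n → f i ≤ℤ sumTo n f
term-≤-sumTo zero    f f≥0 z≤n = ℤP.≤-refl
term-≤-sumTo (suc n) f f≥0 {i} i≤1+n with m≤n⇒m<n∨m≡n i≤1+n
... | inj₁ i<1+n = ℤP.≤-trans (term-≤-sumTo n f f≥0 (≤-pred i<1+n))
                              (ℤP.i≤i+j _ _ {{ℤ.nonNegative (f≥0 (suc n))}})
... | inj₂ refl  = ℤP.i≤j+i _ _ {{ℤ.nonNegative (sumTo-nonNeg n f f≥0)}}

⊛-nonNeg : ∀ {f g} → NonNeg f → NonNeg g → NonNeg (f ⊛ g)
⊛-nonNeg f≥0 g≥0 n = sumTo-nonNeg n _ (λ k → *-nonNeg (f≥0 k) (g≥0 (n ∸ k)))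

⊛-term-≤ : ∀ {f g} → NonNeg f → NonNeg g → ∀ {i n} → i ≤ n → f i ℤ.* g (n ∸ i) ≤ℤ (f ⊛ g) n
⊛-term-≤ f≥0 g≥0 {n = n} = term-≤-sumTo n _ (λ k → *-nonNeg (f≥0 k) (g≥0 (n ∸ k)))

coeff-≤-⊛ : ∀ {f g} → NonNeg f → NonNeg₁ g → ∀ n → f n ≤ℤ (f ⊛ g) n
coeff-≤-⊛ {f} {g} f≥0 (g₀≡1 , g≥0) n = subst (_≤ℤ (f ⊛ g) n) fₙ*g₀≡fₙ (⊛-term-≤ f≥0 g≥0 ≤-refl)
  where
  fₙ*g₀≡fₙ : f n ℤ.* g (n ∸ n) ≡ f n
  fₙ*g₀≡fₙ = trans (cong (λ m → f n ℤ.* g m) (n∸n≡0 n)) (trans (cong (f n ℤ.*_) g₀≡1) (ℤP.*-identityʳ (f n)))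

⊛-nonNeg₁ : ∀ {f g} → NonNeg₁ f → NonNeg₁ g → NonNeg₁ (f ⊛ g)
⊛-nonNeg₁ (f₀≡1 , f≥0) (g₀≡1 , g≥0) = cong₂ ℤ._*_ f₀≡1 g₀≡1 , ⊛-nonNeg f≥0 g≥0

nonNeg₁-resp-≐ : ∀ {f g} → f ≐ g → NonNeg₁ f → NonNeg₁ g
nonNeg₁-resp-≐ f≐g (f₀≡1 , f≥0) =
  trans (sym (coeff f≐g 0)) f₀≡1 , λ n → subst (0ℤ ≤ℤ_) (coeff f≐g n) (f≥0 n)

one-nonNeg₁ : NonNeg₁ one
one-nonNeg₁ = refl , λ { zero → ℤ.+≤+ z≤n ; (suc n) → ℤ.+≤+ z≤n }

mono-nonNeg : ∀ e → NonNeg (mono e)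
mono-nonNeg e n with n ≟ e
... | yes _ = ℤ.+≤+ z≤n
... | no _  = ℤ.+≤+ z≤n

geom-nonNeg₁ : ∀ e → NonNeg₁ (geom e)
geom-nonNeg₁ e = geom-∣ (e ∣0) , nonNeg
  where
  nonNeg : NonNeg (geom e)
  nonNeg n with e ∣? n
  ... | yes _ = ℤ.+≤+ z≤n
  ... | no _  = ℤ.+≤+ z≤n

ratioFactor : ℕ → ℕ → PS
ratioFactor b c = oneMinus (b + c) ⊛ geom b ⊛ geom c

ratioFactor-≐ : ∀ {b c} → 1 ≤ b → 1 ≤ c → ratioFactor b c ≐ geom c +ₛ mono b ⊛ geom b
ratioFactor-≐ {b} {c} 1≤b 1≤c = begin
  oneMinus (b + c) ⊛ geom b ⊛ geom c
    ≈⟨ ⊛-congˡ (geom c) (⊛-congˡ (geom b) (oneMinus-+ b c)) ⟩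
  (oneMinus b +ₛ mono b ⊛ oneMinus c) ⊛ geom b ⊛ geom c
    ≈⟨ ⊛-congˡ (geom c) (⊛-distribʳ-+ₛ (oneMinus b) (mono b ⊛ oneMinus c) (geom b)) ⟩
  (oneMinus b ⊛ geom b +ₛ mono b ⊛ oneMinus c ⊛ geom b) ⊛ geom c
    ≈⟨ ⊛-distribʳ-+ₛ (oneMinus b ⊛ geom b) (mono b ⊛ oneMinus c ⊛ geom b) (geom c) ⟩
  oneMinus b ⊛ geom b ⊛ geom c +ₛ mono b ⊛ oneMinus c ⊛ geom b ⊛ geom c
    ≈⟨ +ₛ-cong (⊛-congˡ (geom c) (oneMinus-geom-inverse 1≤b))
               (solve 4 (λ x y z w → ((x ⊕ y) ⊕ z) ⊕ w ⊜ (x ⊕ z) ⊕ (y ⊕ w)) ≐-refl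
                  (mono b) (oneMinus c) (geom b) (geom c)) ⟩
  one ⊛ geom c +ₛ (mono b ⊛ geom b) ⊛ (oneMinus c ⊛ geom c)
    ≈⟨ +ₛ-cong (⊛-identityˡ (geom c)) (⊛-congʳ (mono b ⊛ geom b) (oneMinus-geom-inverse 1≤c)) ⟩
  geom c +ₛ (mono b ⊛ geom b) ⊛ one
    ≈⟨ +ₛ-cong (≐-refl {geom c}) (⊛-identityʳ (mono b ⊛ geom b)) ⟩
  geom c +ₛ mono b ⊛ geom b ∎
  where open ≐-Reasoning

ratioFactor-nonNeg₁ : ∀ {b c} → 1 ≤ b → 1 ≤ c → NonNeg₁ (ratioFactor b c)
ratioFactor-nonNeg₁ {b} {c} 1≤b 1≤c = nonNeg₁-resp-≐ (≐-sym (ratioFactor-≐ 1≤b 1≤c))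
  ( cong₂ ℤ._+_ (proj₁ (geom-nonNeg₁ c)) (mono-⊛-> b (geom b) 0 1≤b)
  , λ n → ℤP.+-mono-≤ (proj₂ (geom-nonNeg₁ c) n) (⊛-nonNeg (mono-nonNeg b) (proj₂ (geom-nonNeg₁ b)) n))

oneMinus-split : ∀ {b c} → 1 ≤ b → 1 ≤ c → oneMinus (b + c) ≐ ratioFactor b c ⊛ (oneMinus b ⊛ oneMinus c)
oneMinus-split {b} {c} 1≤b 1≤c = ≐-sym (begin
  oneMinus (b + c) ⊛ geom b ⊛ geom c ⊛ (oneMinus b ⊛ oneMinus c)
    ≈⟨ solve 5 (λ x y z u v → ((x ⊕ y) ⊕ z) ⊕ (u ⊕ v) ⊜ x ⊕ ((u ⊕ y) ⊕ (v ⊕ z))) ≐-refl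
         (oneMinus (b + c)) (geom b) (geom c) (oneMinus b) (oneMinus c) ⟩
  oneMinus (b + c) ⊛ ((oneMinus b ⊛ geom b) ⊛ (oneMinus c ⊛ geom c))
    ≈⟨ ⊛-congʳ (oneMinus (b + c)) (⊛-cong (oneMinus-geom-inverse 1≤b) (oneMinus-geom-inverse 1≤c)) ⟩
  oneMinus (b + c) ⊛ (one ⊛ one)
    ≈⟨ ≐-trans (⊛-congʳ (oneMinus (b + c)) (⊛-identityˡ one)) (⊛-identityʳ (oneMinus (b + c))) ⟩
  oneMinus (b + c) ∎)
  where open ≐-Reasoning

-- Finite products

prod : {A : Set} → (A → PS) → List A → PS
prod f []       = one
prod f (x ∷ xs) = f x ⊛ prod f xs

prod-++ : ∀ {A : Set} (f : A → PS) xs ys → prod f (xs ++ ys) ≐ prod f xs ⊛ prod f ys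
prod-++ f []       ys = ≐-sym (⊛-identityˡ (prod f ys))
prod-++ f (x ∷ xs) ys = ≐-trans (⊛-congʳ (f x) (prod-++ f xs ys)) (≐-sym (⊛-assoc (f x) (prod f xs) (prod f ys)))

prod-concat : ∀ {A : Set} (f : A → PS) xss → prod f (concat xss) ≐ prod (prod f) xss
prod-concat f []         = ≐-refl
prod-concat f (xs ∷ xss) = ≐-trans (prod-++ f xs (concat xss)) (⊛-congʳ (prod f xs) (prod-concat f xss))

prod-nonNeg₁ : ∀ {A : Set} {f : A → PS} xs → (∀ x → NonNeg₁ (f x)) → NonNeg₁ (prod f xs)
prod-nonNeg₁ []       f≥0 = one-nonNeg₁
prod-nonNeg₁ (x ∷ xs) f≥0 = ⊛-nonNeg₁ (f≥0 x) (prod-nonNeg₁ xs f≥0)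

parity : ∀ n → (∃[ q ] n ≡ 2 * q) ⊎ (∃[ q ] n ≡ suc (2 * q))
parity zero = inj₁ (0 , refl)
parity (suc n) with parity n
... | inj₁ (q , n≡2q)   = inj₂ (q , cong suc n≡2q)
... | inj₂ (q , n≡1+2q) = inj₁ (suc q , trans (cong suc n≡1+2q) (sym (*-suc 2 q)))

-- N is a sum of 2s and at most one s: the 2s make up N if N is even and N - s otherwise.
geom-2-odd-positive : ∀ r {N} → suc (2 * r) ≤ N → 1ℤ ≤ℤ prod geom (2 ∷ suc (2 * r) ∷ []) N
geom-2-odd-positive r {N} s≤N = subst (1ℤ ≤ℤ_) (coeff (⊛-congʳ (geom 2) (≐-sym (⊛-identityʳ (geom s)))) N) positive
  where
  s = suc (2 * r)
  from-term : ∀ {i} → i ≤ N → geom 2 i ℤ.* geom s (N ∸ i) ≡ 1ℤ → 1ℤ ≤ℤ (geom 2 ⊛ geom s) N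
  from-term i≤N term≡1 =
    ℤP.≤-trans (ℤP.≤-reflexive (sym term≡1)) (⊛-term-≤ (proj₂ (geom-nonNeg₁ 2)) (proj₂ (geom-nonNeg₁ s)) i≤N)
  positive : 1ℤ ≤ℤ (geom 2 ⊛ geom s) N
  positive with parity N
  ... | inj₁ (q , N≡2q)   = from-term ≤-refl
    (cong₂ ℤ._*_ (geom-∣ (divides q (trans N≡2q (*-comm 2 q)))) (trans (cong (geom s) (n∸n≡0 N)) (geom-∣ (s ∣0))))
  ... | inj₂ (q , N≡1+2q) = from-term (m∸n≤m N s)
    (cong₂ ℤ._*_ (geom-∣ (divides (q ∸ r) N∸s≡[q∸r]*2)) (trans (cong (geom s) (m∸[m∸n]≡n s≤N)) (geom-∣ ∣-refl)))
    where
    N∸s≡[q∸r]*2 : N ∸ s ≡ (q ∸ r) * 2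
    N∸s≡[q∸r]*2 = trans (cong (_∸ s) N≡1+2q) (trans (sym (*-distribˡ-∸ 2 q r)) (*-comm 2 (q ∸ r)))

geom-1-positive : ∀ N → 1ℤ ≤ℤ prod geom (1 ∷ []) N
geom-1-positive N =
  ℤP.≤-reflexive (sym (trans (coeff (⊛-identityʳ (geom 1)) N) (geom-∣ (divides N (sym (*-identityʳ N))))))

prod-oneMinus-split : ∀ {f b c : ℕ → ℕ} m →
  (∀ j → b j + c j ≡ f j) → (∀ j → 1 ≤ b j) → (∀ j → 1 ≤ c j) →
  prod oneMinus (applyDownFrom f m)
    ≐ prod (λ j → ratioFactor (b j) (c j)) (downFrom m)
      ⊛ (prod oneMinus (applyDownFrom b m) ⊛ prod oneMinus (applyDownFrom c m))
prod-oneMinus-split zero b+c≡f b≥1 c≥1 = ≐-sym (≐-trans (⊛-identityˡ (one ⊛ one)) (⊛-identityˡ one))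
prod-oneMinus-split {f} {b} {c} (suc m) b+c≡f b≥1 c≥1 = ≐-trans
  (⊛-cong (≐-trans (≡⇒≐ (cong oneMinus (sym (b+c≡f m)))) (oneMinus-split (b≥1 m) (c≥1 m)))
          (prod-oneMinus-split m b+c≡f b≥1 c≥1))
  (solve 6 (λ r x y rs xs ys → (r ⊕ (x ⊕ y)) ⊕ (rs ⊕ (xs ⊕ ys)) ⊜ (r ⊕ rs) ⊕ ((x ⊕ xs) ⊕ (y ⊕ ys))) ≐-refl
     (ratioFactor (b m) (c m)) (oneMinus (b m)) (oneMinus (c m)) (prod (λ j → ratioFactor (b j) (c j)) (downFrom m))
     (prod oneMinus (applyDownFrom b m)) (prod oneMinus (applyDownFrom c m)))

infixr 8 _^_
_^_ : PS → ℕ → PS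
f ^ zero  = one
f ^ suc k = f ⊛ f ^ k

^-cong : ∀ {f g} k → f ≐ g → f ^ k ≐ g ^ k
^-cong zero    f≐g = ≐-refl
^-cong (suc k) f≐g = ⊛-cong f≐g (^-cong k f≐g)

^-identityʳ : ∀ f → f ^ 1 ≐ f
^-identityʳ f = ⊛-identityʳ f

^-distribˡ-+ : ∀ f a b → f ^ (a + b) ≐ f ^ a ⊛ f ^ b
^-distribˡ-+ f zero    b = ≐-sym (⊛-identityˡ (f ^ b))
^-distribˡ-+ f (suc a) b = ≐-trans (⊛-congʳ f (^-distribˡ-+ f a b)) (≐-sym (⊛-assoc f (f ^ a) (f ^ b)))

^-distribʳ-⊛ : ∀ f g k → (f ⊛ g) ^ k ≐ f ^ k ⊛ g ^ k
^-distribʳ-⊛ f g zero    = ≐-sym (⊛-identityˡ one)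
^-distribʳ-⊛ f g (suc k) = ≐-trans (⊛-congʳ (f ⊛ g) (^-distribʳ-⊛ f g k)) (⊛-interchange f g (f ^ k) (g ^ k))

one-^ : ∀ k → one ^ k ≐ one
one-^ zero    = ≐-refl
one-^ (suc k) = ≐-trans (⊛-identityˡ (one ^ k)) (one-^ k)

^-nonNeg₁ : ∀ {f} k → NonNeg₁ f → NonNeg₁ (f ^ k)
^-nonNeg₁ zero    f≥0 = one-nonNeg₁
^-nonNeg₁ (suc k) f≥0 = ⊛-nonNeg₁ f≥0 (^-nonNeg₁ k f≥0)

prodPow : ℕ → (ℕ → PS) → (ℕ → ℕ) → PS
prodPow zero    h E = one
prodPow (suc N) h E = prodPow N h E ⊛ h (suc N) ^ E (suc N)

prodPow-congʳ : ∀ N h {E F} → (∀ k → 1 ≤ k → k ≤ N → E k ≡ F k) → prodPow N h E ≐ prodPow N h F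
prodPow-congʳ zero    h E≗F = ≐-refl
prodPow-congʳ (suc N) h E≗F = ⊛-cong (prodPow-congʳ N h (λ k 1≤k k≤N → E≗F k 1≤k (m≤n⇒m≤1+n k≤N)))
  (≡⇒≐ (cong (h (suc N) ^_) (E≗F (suc N) (s≤s z≤n) ≤-refl)))

prodPow-+ : ∀ N h E F → prodPow N h (λ k → E k + F k) ≐ prodPow N h E ⊛ prodPow N h F
prodPow-+ zero    h E F = ≐-sym (⊛-identityˡ one)
prodPow-+ (suc N) h E F = ≐-trans
  (⊛-cong (prodPow-+ N h E F) (^-distribˡ-+ (h (suc N)) (E (suc N)) (F (suc N))))
  (⊛-interchange (prodPow N h E) (prodPow N h F) (h (suc N) ^ E (suc N)) (h (suc N) ^ F (suc N)))

prodPow-⊛ : ∀ N h g E → prodPow N (λ k → h k ⊛ g k) E ≐ prodPow N h E ⊛ prodPow N g E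
prodPow-⊛ zero    h g E = ≐-sym (⊛-identityˡ one)
prodPow-⊛ (suc N) h g E = ≐-trans
  (⊛-cong (prodPow-⊛ N h g E) (^-distribʳ-⊛ (h (suc N)) (g (suc N)) (E (suc N))))
  (⊛-interchange (prodPow N h E) (prodPow N g E) (h (suc N) ^ E (suc N)) (g (suc N) ^ E (suc N)))

prodPow-one : ∀ N h E → (∀ k → 1 ≤ k → h k ≐ one) → prodPow N h E ≐ one
prodPow-one zero    h E h≐1 = ≐-refl
prodPow-one (suc N) h E h≐1 = ≐-trans
  (⊛-cong (prodPow-one N h E h≐1) (≐-trans (^-cong (E (suc N)) (h≐1 (suc N) (s≤s z≤n))) (one-^ (E (suc N)))))
  (⊛-identityˡ one)

prodPow-zero : ∀ N h → prodPow N h (λ _ → 0) ≐ one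
prodPow-zero zero    h = ≐-refl
prodPow-zero (suc N) h = ≐-trans (⊛-identityʳ (prodPow N h (λ _ → 0))) (prodPow-zero N h)

prodPow-nonNeg₁ : ∀ N {h} E → (∀ k → NonNeg₁ (h k)) → NonNeg₁ (prodPow N h E)
prodPow-nonNeg₁ zero    E h≥0 = one-nonNeg₁
prodPow-nonNeg₁ (suc N) E h≥0 = ⊛-nonNeg₁ (prodPow-nonNeg₁ N E h≥0) (^-nonNeg₁ (E (suc N)) (h≥0 (suc N)))

prodPow-oneMinus-geom : ∀ N E → prodPow N oneMinus E ⊛ prodPow N geom E ≐ one
prodPow-oneMinus-geom N E = ≐-trans (≐-sym (prodPow-⊛ N oneMinus geom E))
  (prodPow-one N (λ k → oneMinus k ⊛ geom k) E (λ k 1≤k → oneMinus-geom-inverse 1≤k))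

prodPow-complement : ∀ N E S → (∀ k → E k + S k ≤ 1) →
  prodPow N oneMinus (λ _ → 1) ⊛ (prodPow N geom S ⊛ prodPow N geom (λ k → 1 ∸ (E k + S k)))
    ≐ prodPow N oneMinus E
prodPow-complement N E S E+S≤1 = begin
  prodPow N oneMinus (λ _ → 1) ⊛ (geomS ⊛ geomW)
    ≈⟨ ⊛-congˡ (geomS ⊛ geomW) (prodPow-congʳ N oneMinus (λ k _ _ → partition k)) ⟩
  prodPow N oneMinus (λ k → E k + (S k + W k)) ⊛ (geomS ⊛ geomW)
    ≈⟨ ⊛-congˡ (geomS ⊛ geomW) (≐-trans (prodPow-+ N oneMinus E _) (⊛-congʳ omE (prodPow-+ N oneMinus S W))) ⟩
  (omE ⊛ (omS ⊛ omW)) ⊛ (geomS ⊛ geomW)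
    ≈⟨ ⊛-assoc omE (omS ⊛ omW) (geomS ⊛ geomW) ⟩
  omE ⊛ ((omS ⊛ omW) ⊛ (geomS ⊛ geomW))
    ≈⟨ ⊛-congʳ omE (⊛-interchange omS omW geomS geomW) ⟩
  omE ⊛ ((omS ⊛ geomS) ⊛ (omW ⊛ geomW))
    ≈⟨ ⊛-congʳ omE (⊛-cong (prodPow-oneMinus-geom N S) (prodPow-oneMinus-geom N W)) ⟩
  omE ⊛ (one ⊛ one)
    ≈⟨ ≐-trans (⊛-congʳ omE (⊛-identityˡ one)) (⊛-identityʳ omE) ⟩
  omE ∎
  where
  open ≐-Reasoning
  W : ℕ → ℕ
  W k = 1 ∸ (E k + S k)
  omE omS omW geomS geomW : PS
  omE = prodPow N oneMinus E
  omS = prodPow N oneMinus S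
  omW = prodPow N oneMinus W
  geomS = prodPow N geom S
  geomW = prodPow N geom W
  partition : ∀ k → 1 ≡ E k + (S k + W k)
  partition k = trans (sym (m+[n∸m]≡n (E+S≤1 k))) (+-assoc (E k) (S k) (W k))

indicator : ℕ → ℕ → ℕ
indicator e k with e ≟ k
... | yes _ = 1
... | no  _ = 0

indicator-self : ∀ e → indicator e e ≡ 1
indicator-self e with e ≟ e
... | yes _  = refl
... | no e≢e = ⊥-elim (e≢e refl)

indicator-≢ : ∀ {e k} → e ≢ k → indicator e k ≡ 0
indicator-≢ {e} {k} e≢k with e ≟ k
... | yes e≡k = ⊥-elim (e≢k e≡k)
... | no _    = refl

prodPow-indicator : ∀ N h {e} → 1 ≤ e → e ≤ N → prodPow N h (indicator e) ≐ h e
prodPow-indicator zero    h (s≤s _) ()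
prodPow-indicator (suc N) h {e} 1≤e e≤1+N with m≤n⇒m<n∨m≡n e≤1+N
... | inj₁ e<1+N = ≐-trans
  (⊛-cong (prodPow-indicator N h 1≤e (≤-pred e<1+N)) (≡⇒≐ (cong (h (suc N) ^_) (indicator-≢ (<⇒≢ e<1+N)))))
  (⊛-identityʳ (h e))
... | inj₂ refl = ≐-trans
  (⊛-cong (≐-trans (prodPow-congʳ N h (λ k _ k≤N → indicator-≢ (>⇒≢ (s≤s k≤N)))) (prodPow-zero N h))
          (≐-trans (≡⇒≐ (cong (h (suc N) ^_) (indicator-self (suc N)))) (^-identityʳ (h (suc N)))))
  (⊛-identityˡ (h (suc N)))

multiplicity : List ℕ → ℕ → ℕ
multiplicity []       k = 0
multiplicity (e ∷ es) k = indicator e k + multiplicity es k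

multiplicity-++ : ∀ xs ys k → multiplicity (xs ++ ys) k ≡ multiplicity xs k + multiplicity ys k
multiplicity-++ []       ys k = refl
multiplicity-++ (e ∷ es) ys k =
  trans (cong (indicator e k +_) (multiplicity-++ es ys k)) (sym (+-assoc (indicator e k) _ _))

multiplicity-concat : ∀ xss k → multiplicity (concat xss) k ≡ sum (map (λ xs → multiplicity xs k) xss)
multiplicity-concat []         k = refl
multiplicity-concat (xs ∷ xss) k =
  trans (multiplicity-++ xs (concat xss) k) (cong (multiplicity xs k +_) (multiplicity-concat xss k))

multiplicity-∉ : ∀ {k} xs → k ∉ xs → multiplicity xs k ≡ 0
multiplicity-∉ []       k∉xs = refl
multiplicity-∉ (e ∷ es) k∉xs =
  cong₂ _+_ (indicator-≢ (λ e≡k → k∉xs (here (sym e≡k)))) (multiplicity-∉ es (k∉xs ∘ there))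

multiplicity-unique : ∀ {xs} → Unique xs → ∀ k → multiplicity xs k ≤ 1
multiplicity-unique []                    k = z≤n
multiplicity-unique {e ∷ es} (e∉es ∷ uniq) k with e ≟ k
... | yes refl = ≤-reflexive (cong suc (multiplicity-∉ es (Allₚ.All¬⇒¬Any e∉es)))
... | no _     = multiplicity-unique uniq k

prod-≈-prodPow : ∀ N h → (∀ e → N < e → h e ≈[ N ] one) →
  ∀ xs → All (1 ≤_) xs → prod h xs ≈[ N ] prodPow N h (multiplicity xs)
prod-≈-prodPow N h h≈1 []       []           = ≐⇒≈ N (≐-sym (prodPow-zero N h))
prod-≈-prodPow N h h≈1 (e ∷ es) (1≤e ∷ es≥1) with e ≤? N
... | yes e≤N = begin
  h e ⊛ prod h es                      ≈⟨ ⊛-cong-≈ (≈-refl {h e}) IH ⟩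
  h e ⊛ rest                           ≈⟨ ≐⇒≈ N (⊛-congˡ rest (≐-sym (prodPow-indicator N h 1≤e e≤N))) ⟩
  prodPow N h (indicator e) ⊛ rest     ≈⟨ ≐⇒≈ N (≐-sym (prodPow-+ N h (indicator e) (multiplicity es))) ⟩
  prodPow N h (multiplicity (e ∷ es))  ∎
  where
  open ≈-Reasoning N
  rest = prodPow N h (multiplicity es)
  IH = prod-≈-prodPow N h h≈1 es es≥1
... | no e≰N = begin
  h e ⊛ prod h es                      ≈⟨ ⊛-cong-≈ (h≈1 e (≰⇒> e≰N)) IH ⟩
  one ⊛ prodPow N h (multiplicity es)  ≈⟨ ≐⇒≈ N (⊛-identityˡ _) ⟩
  prodPow N h (multiplicity es)        ≈⟨ ≐⇒≈ N (prodPow-congʳ N h absent) ⟩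
  prodPow N h (multiplicity (e ∷ es))  ∎
  where
  open ≈-Reasoning N
  IH = prod-≈-prodPow N h h≈1 es es≥1
  absent : ∀ k → 1 ≤ k → k ≤ N → multiplicity es k ≡ indicator e k + multiplicity es k
  absent k _ k≤N = cong (_+ multiplicity es k) (sym (indicator-≢ (λ e≡k → e≰N (subst (_≤ N) (sym e≡k) k≤N))))

-- Truncated Pochhammer symbols and division by (q;q)_∞

exponents : ℕ → ℕ → ℕ → List ℕ
exponents a b m = applyDownFrom (λ j → a + b * j) m

partialPoch-≐-prod : ∀ a b m → partialPoch a b m ≐ prod oneMinus (exponents a b m)
partialPoch-≐-prod a b zero    = ≐-refl
partialPoch-≐-prod a b (suc m) = ≐-trans (⊛-congˡ (oneMinus (a + b * m)) (partialPoch-≐-prod a b m))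
                                         (⊛-comm (prod oneMinus (exponents a b m)) (oneMinus (a + b * m)))

index<exponent : ∀ {a b} j → 1 ≤ a → 1 ≤ b → j < a + b * j
index<exponent {b = b} j 1≤a 1≤b = +-mono-≤ 1≤a (subst (_≤ b * j) (*-identityˡ j) (*-monoˡ-≤ j 1≤b))

partialPoch-stable : ∀ {a b n} → 1 ≤ a → 1 ≤ b → ∀ m → n < m → partialPoch a b m ≈[ n ] partialPoch a b (suc n)
partialPoch-stable {a} {b} {n} 1≤a 1≤b (suc m) n<1+m with m≤n⇒m<n∨m≡n (≤-pred n<1+m)
... | inj₂ refl = ≈-refl
... | inj₁ n<m  = begin
  partialPoch a b m ⊛ oneMinus (a + b * m) ≈⟨ ⊛-cong-≈ (partialPoch-stable 1≤a 1≤b m n<m)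
                                                    (oneMinus-≈-one (<-trans n<m (index<exponent m 1≤a 1≤b))) ⟩
  partialPoch a b (suc n) ⊛ one            ≈⟨ ≐⇒≈ n (⊛-identityʳ _) ⟩
  partialPoch a b (suc n)                  ∎
  where open ≈-Reasoning n

poch-≈-partialPoch : ∀ {a b} N → 1 ≤ a → 1 ≤ b → poch a b ≈[ N ] partialPoch a b (suc N)
poch-≈-partialPoch N 1≤a 1≤b =
  mk≈ λ n n≤N → sym (coeff≤ (partialPoch-stable 1≤a 1≤b (suc N) (s≤s n≤N)) n ≤-refl)

poch-≈-prod : ∀ {a b} N → 1 ≤ a → 1 ≤ b → poch a b ≈[ N ] prod oneMinus (exponents a b (suc N))
poch-≈-prod {a} {b} N 1≤a 1≤b = ≈-trans (poch-≈-partialPoch N 1≤a 1≤b) (≐⇒≈ N (partialPoch-≐-prod a b (suc N)))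

partialPoch-1-1 : ∀ m → partialPoch 1 1 m ≐ prodPow m oneMinus (λ _ → 1)
partialPoch-1-1 zero    = ≐-refl
partialPoch-1-1 (suc m) = ⊛-cong (partialPoch-1-1 m)
  (≐-trans (≡⇒≐ (cong (λ e → oneMinus (suc e)) (*-identityˡ m))) (≐-sym (^-identityʳ (oneMinus (suc m)))))

qPoch-≈-prodPow : ∀ N → qPoch ≈[ N ] prodPow N oneMinus (λ _ → 1)
qPoch-≈-prodPow N = begin
  qPoch                                                ≈⟨ poch-≈-partialPoch N ≤-refl ≤-refl ⟩
  partialPoch 1 1 (suc N)                              ≈⟨ ≐⇒≈ N (partialPoch-1-1 (suc N)) ⟩
  prodPow N oneMinus (λ _ → 1) ⊛ oneMinus (suc N) ^ 1  ≈⟨ ⊛-cong-≈ (≈-refl {prodPow N oneMinus (λ _ → 1)})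
                                                            (≈-trans (≐⇒≈ N (^-identityʳ _)) (oneMinus-≈-one ≤-refl)) ⟩
  prodPow N oneMinus (λ _ → 1) ⊛ one                   ≈⟨ ≐⇒≈ N (⊛-identityʳ _) ⟩
  prodPow N oneMinus (λ _ → 1)                         ∎
  where open ≈-Reasoning N

⊛-cancelˡ-≈ : ∀ {f g h} N → f 0 ≡ 1ℤ → f ⊛ g ≈[ N ] f ⊛ h → g ≈[ N ] h
⊛-cancelˡ-≈ {f} {g} {h} N f₀≡1 fg≈fh = mk≈ (cancel N ≤-refl)
  where
  gf≈hf : ∀ n → n ≤ N → (g ⊛ f) n ≡ (h ⊛ f) n
  gf≈hf n n≤N = trans (coeff (⊛-comm g f) n) (trans (coeff≤ fg≈fh n n≤N) (coeff (⊛-comm f h) n))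
  scale : ∀ x n → x ℤ.* f (n ∸ n) ≡ x
  scale x n = trans (cong (λ m → x ℤ.* f m) (n∸n≡0 n)) (trans (cong (x ℤ.*_) f₀≡1) (ℤP.*-identityʳ x))
  cancel : ∀ M → M ≤ N → ∀ n → n ≤ M → g n ≡ h n
  cancel zero    0≤N zero z≤n = trans (sym (scale (g 0) 0)) (trans (gf≈hf 0 0≤N) (scale (h 0) 0))
  cancel (suc M) M<N n n≤1+M with m≤n⇒m<n∨m≡n n≤1+M
  ... | inj₁ n<1+M = cancel M (<⇒≤ M<N) n (≤-pred n<1+M)
  ... | inj₂ refl  = begin
    g (suc M)                                                  ≡⟨ scale (g (suc M)) (suc M) ⟨
    g (suc M) ℤ.* f (M ∸ M)                                    ≡⟨ ∙-cancelˡ (lower g) _ _ top ⟩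
    h (suc M) ℤ.* f (M ∸ M)                                    ≡⟨ scale (h (suc M)) (suc M) ⟩
    h (suc M)                                                  ∎
    where
    open ≡-Reasoning
    lower : PS → ℤ
    lower x = sumTo M (λ k → x k ℤ.* f (suc M ∸ k))
    top : lower g ℤ.+ g (suc M) ℤ.* f (M ∸ M) ≡ lower g ℤ.+ h (suc M) ℤ.* f (M ∸ M)
    top = trans (gf≈hf (suc M) M<N) (cong (ℤ._+ h (suc M) ℤ.* f (M ∸ M)) (sumTo-cong M λ k k≤M →
      cong (ℤ._* f (suc M ∸ k)) (sym (cancel M (<⇒≤ M<N) k k≤M))))

quotient-≈ : ∀ N {F Y c : PS} xs ss → All (1 ≤_) xs → (∀ k → multiplicity xs k + multiplicity ss k ≤ 1) →
  F ≈[ N ] prod oneMinus xs ⊛ Y → qPoch ⊛ c ≈[ N ] F →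
  c ≈[ N ] prodPow N geom (multiplicity ss) ⊛ (prodPow N geom (λ k → 1 ∸ (multiplicity xs k + multiplicity ss k)) ⊛ Y)
quotient-≈ N {F} {Y} {c} xs ss xs≥1 E+S≤1 F≈ qPoch⊛c≈F = ⊛-cancelˡ-≈ {qPoch} N refl (≈-trans qPoch⊛c≈F (begin
  F                                           ≈⟨ F≈ ⟩
  prod oneMinus xs ⊛ Y                        ≈⟨ ⊛-cong-≈ (prod-≈-prodPow N oneMinus (λ _ → oneMinus-≈-one) xs xs≥1)
                                                           (≈-refl {Y}) ⟩
  prodPow N oneMinus E ⊛ Y                    ≈⟨ ≐⇒≈ N (⊛-congˡ Y (prodPow-complement N E S E+S≤1)) ⟨
  P ⊛ (G ⊛ Gᶜ) ⊛ Y                            ≈⟨ ≐⇒≈ N (≐-trans (⊛-assoc P (G ⊛ Gᶜ) Y)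
                                                                   (⊛-congʳ P (⊛-assoc G Gᶜ Y))) ⟩
  P ⊛ (G ⊛ (Gᶜ ⊛ Y))                          ≈⟨ ⊛-cong-≈ (qPoch-≈-prodPow N) (≈-refl {G ⊛ (Gᶜ ⊛ Y)}) ⟨
  qPoch ⊛ (G ⊛ (Gᶜ ⊛ Y))                      ∎))
  where
  open ≈-Reasoning N
  E S : ℕ → ℕ
  E = multiplicity xs
  S = multiplicity ss
  P G Gᶜ : PS
  P  = prodPow N oneMinus (λ _ → 1)
  G  = prodPow N geom S
  Gᶜ = prodPow N geom (λ k → 1 ∸ (E k + S k))

quotient-coeff-positive : ∀ N {F Y : PS} xs ss → All (1 ≤_) xs → All (1 ≤_) ss →
  (∀ k → multiplicity xs k + multiplicity ss k ≤ 1) →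
  F ≈[ N ] prod oneMinus xs ⊛ Y → NonNeg₁ Y → 1ℤ ≤ℤ prod geom ss N →
  ∀ c → qPoch ⊛ c ≈[ N ] F → 0ℤ <ℤ c N
quotient-coeff-positive N {Y = Y} xs ss xs≥1 ss≥1 E+S≤1 F≈ Y≥0 spare≥1 c qPoch⊛c≈F =
  ℤP.<-≤-trans (ℤ.+<+ (s≤s z≤n)) (begin
    1ℤ                   ≤⟨ spare≥1 ⟩
    prod geom ss N       ≡⟨ coeff≤ (prod-≈-prodPow N geom (λ _ → geom-≈-one) ss ss≥1) N ≤-refl ⟩
    G N                  ≤⟨ coeff-≤-⊛ (proj₂ (prodPow-nonNeg₁ N _ geom-nonNeg₁)) rest≥0 N ⟩
    (G ⊛ (Gᶜ ⊛ Y)) N     ≡⟨ coeff≤ (quotient-≈ N {Y = Y} {c} xs ss xs≥1 E+S≤1 F≈ qPoch⊛c≈F) N ≤-refl ⟨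
    c N                  ∎)
  where
  open ℤP.≤-Reasoning
  G Gᶜ : PS
  G  = prodPow N geom (multiplicity ss)
  Gᶜ = prodPow N geom (λ k → 1 ∸ (multiplicity xs k + multiplicity ss k))
  rest≥0 : NonNeg₁ (Gᶜ ⊛ Y)
  rest≥0 = ⊛-nonNeg₁ (prodPow-nonNeg₁ N _ geom-nonNeg₁) Y≥0

-- Residue classes of exponents

InClass : (M : ℕ) .{{_ : NonZero M}} → ℕ → List ℕ → Set
InClass M r xs = All (λ k → k % M ≡ r) xs

exponents-inClass : ∀ {M} .{{_ : NonZero M}} {r} a b m → M ∣ b → a % M ≡ r → InClass M r (exponents a b m)
exponents-inClass {M} a b m (divides d b≡d*M) a%M≡r = Allₚ.applyDownFrom⁺₁ _ m λ {j} _ → begin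
  (a + b * j) % M       ≡⟨ cong (λ x → (a + x) % M) b*j≡[d*j]*M ⟩
  (a + d * j * M) % M   ≡⟨ [m+kn]%n≡m%n a (d * j) M ⟩
  a % M                 ≡⟨ a%M≡r ⟩
  _                     ∎
  where
  open ≡-Reasoning
  b*j≡[d*j]*M : ∀ {j} → b * j ≡ d * j * M
  b*j≡[d*j]*M {j} =
    trans (cong (_* j) b≡d*M) (trans (*-assoc d M j) (trans (cong (d *_) (*-comm M j)) (sym (*-assoc d j M))))

inClass-∉ : ∀ {M} .{{_ : NonZero M}} {r xs k} → InClass M r xs → k % M ≢ r → k ∉ xs
inClass-∉ xs⊆r k%M≢r k∈xs = k%M≢r (lookup xs⊆r k∈xs)

inClass-disjoint : ∀ {M} .{{_ : NonZero M}} {r r′ xs ys} → InClass M r xs → InClass M r′ ys → r ≢ r′ → Disjoint xs ys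
inClass-disjoint xs⊆r ys⊆r′ r≢r′ (v∈xs , v∈ys) = r≢r′ (trans (sym (lookup xs⊆r v∈xs)) (lookup ys⊆r′ v∈ys))

inClasses-disjoint : ∀ {M} .{{_ : NonZero M}} {rs xss} →
  Pointwise (λ r xs → InClass M r xs) rs xss → AllPairs _≢_ rs → AllPairs Disjoint xss
inClasses-disjoint []         []            = []
inClasses-disjoint (xs⊆r ∷ ⊆rs) (r≢rs ∷ ≢rs) = apart xs⊆r ⊆rs r≢rs ∷ inClasses-disjoint ⊆rs ≢rs
  where
  apart : ∀ {M} .{{_ : NonZero M}} {r xs rs yss} → InClass M r xs →
    Pointwise (λ r ys → InClass M r ys) rs yss → All (r ≢_) rs → All (Disjoint xs) yss
  apart xs⊆r []             []             = []
  apart xs⊆r (ys⊆r′ ∷ ⊆rs) (r≢r′ ∷ r≢rs) = inClass-disjoint xs⊆r ys⊆r′ r≢r′ ∷ apart xs⊆r ⊆rs r≢rs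

exponents-unique : ∀ a b m → 1 ≤ b → Unique (exponents a b m)
exponents-unique a (suc b) m _ = Uniqueₚ.applyDownFrom⁺₁ _ m λ j<i _ eq →
  <⇒≢ j<i (sym (*-cancelˡ-≡ _ _ (suc b) (+-cancelˡ-≡ a _ _ eq)))

exponents-positive : ∀ a b m → 1 ≤ a → All (1 ≤_) (exponents a b m)
exponents-positive a b m 1≤a = Allₚ.applyDownFrom⁺₁ _ m λ _ → ≤-trans 1≤a (m≤m+n a _)

∉-concat : ∀ {k xss} → All (k ∉_) xss → k ∉ concat {A = ℕ} xss
∉-concat {xss = xss} k∉xss k∈concat = Allₚ.All¬⇒¬Any k∉xss (∈-concat⁻ xss k∈concat)

-- The quintuple product

module Exponents (ℓ p N : ℕ) where

  A₁ A₂ A₃ B₁ B₂ : List ℕ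
  A₁ = exponents ℓ p (suc N)
  A₂ = exponents (p ∸ ℓ) p (suc N)
  A₃ = exponents p p (suc N)
  B₁ = exponents (p + 2 * ℓ) (2 * p) (suc N)
  B₂ = exponents (p ∸ 2 * ℓ) (2 * p) (suc N)

  quintuple-≈-prod : 1 ≤ ℓ → 2 * ℓ < p →
    quintuple ℓ p ≈[ N ]
      prod oneMinus A₁ ⊛ prod oneMinus A₂ ⊛ prod oneMinus A₃ ⊛ prod oneMinus B₁ ⊛ prod oneMinus B₂
  quintuple-≈-prod 1≤ℓ 2ℓ<p =
    ⊛-cong-≈ (⊛-cong-≈ (⊛-cong-≈ (⊛-cong-≈ (poch-≈-prod N 1≤ℓ 1≤p) (poch-≈-prod N (m<n⇒0<n∸m ℓ<p) 1≤p))
      (poch-≈-prod N 1≤p 1≤p)) (poch-≈-prod N (≤-trans 1≤p (m≤m+n p _)) 1≤2p))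
      (poch-≈-prod N (m<n⇒0<n∸m 2ℓ<p) 1≤2p)
    where
    ℓ<p : ℓ < p
    ℓ<p = <-≤-trans (m<m+n ℓ 1≤ℓ) (subst (_≤ p) (cong (ℓ +_) (+-identityʳ ℓ)) (<⇒≤ 2ℓ<p))
    1≤p : 1 ≤ p
    1≤p = ≤-trans 1≤ℓ (<⇒≤ ℓ<p)
    1≤2p : 1 ≤ 2 * p
    1≤2p = ≤-trans 1≤p (m≤m+n p _)

module GenericCase {ℓ p : ℕ} (1≤ℓ : 1 ≤ ℓ) (2ℓ<p : 2 * ℓ < p) (10<p : 10 < p) (p≢3ℓ : p ≢ 3 * ℓ) (N : ℕ) where
  open Exponents ℓ p N

  2ℓ≤p : 2 * ℓ ≤ p
  2ℓ≤p = <⇒≤ 2ℓ<p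
  ℓ<2ℓ : ℓ < 2 * ℓ
  ℓ<2ℓ = m<m+n ℓ (subst (1 ≤_) (sym (+-identityʳ ℓ)) 1≤ℓ)
  ℓ<p : ℓ < p
  ℓ<p = <-trans ℓ<2ℓ 2ℓ<p
  1≤p : 1 ≤ p
  1≤p = ≤-trans 1≤ℓ (<⇒≤ ℓ<p)
  p<2p : p < 2 * p
  p<2p = m<m+n p (subst (1 ≤_) (sym (+-identityʳ p)) 1≤p)
  p∸2ℓ<p : p ∸ 2 * ℓ < p
  p∸2ℓ<p = ∸-monoʳ-< (<-≤-trans (s≤s z≤n) ℓ<2ℓ) 2ℓ≤p

  instance
    p-nonZero : NonZero p
    p-nonZero = >-nonZero 1≤p
    2p-nonZero : NonZero (2 * p)
    2p-nonZero = >-nonZero (<-trans 1≤p p<2p)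

  p∣2p : p ∣ 2 * p
  p∣2p = divides 2 refl

  A₁-class : InClass p ℓ A₁
  A₁-class = exponents-inClass ℓ p (suc N) ∣-refl (m<n⇒m%n≡m ℓ<p)
  A₂-class : InClass p (p ∸ ℓ) A₂
  A₂-class = exponents-inClass (p ∸ ℓ) p (suc N) ∣-refl (m<n⇒m%n≡m (∸-monoʳ-< 1≤ℓ (<⇒≤ ℓ<p)))
  A₃-class : InClass p 0 A₃
  A₃-class = exponents-inClass p p (suc N) ∣-refl (n%n≡0 p)
  B₁-class : InClass p (2 * ℓ) B₁
  B₁-class = exponents-inClass (p + 2 * ℓ) (2 * p) (suc N) p∣2p
    (trans (cong (_% p) (+-comm p (2 * ℓ))) (trans ([m+n]%n≡m%n (2 * ℓ) p) (m<n⇒m%n≡m 2ℓ<p)))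
  B₁-class₂ : InClass (2 * p) (p + 2 * ℓ) B₁
  B₁-class₂ = exponents-inClass (p + 2 * ℓ) (2 * p) (suc N) ∣-refl
    (m<n⇒m%n≡m (subst (p + 2 * ℓ <_) (cong (p +_) (sym (+-identityʳ p))) (+-monoʳ-< p 2ℓ<p)))
  B₂-class : InClass p (p ∸ 2 * ℓ) B₂
  B₂-class = exponents-inClass (p ∸ 2 * ℓ) (2 * p) (suc N) p∣2p (m<n⇒m%n≡m p∸2ℓ<p)
  B₂-class₂ : InClass (2 * p) (p ∸ 2 * ℓ) B₂
  B₂-class₂ = exponents-inClass (p ∸ 2 * ℓ) (2 * p) (suc N) ∣-refl (m<n⇒m%n≡m (<-trans p∸2ℓ<p p<2p))

  families : List (List ℕ)
  families = A₁ ∷ A₂ ∷ A₃ ∷ B₁ ∷ B₂ ∷ []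

  -- Residues mod p are ±ℓ, 0, ±2ℓ; they are distinct since p ≢ 3ℓ, except that ±2ℓ
  -- coincide when p = 4ℓ, where B₁ and B₂ are told apart mod 2p.
  families-unique : Unique (concat families)
  families-unique = Uniqueₚ.concat⁺
    (exponents-unique ℓ p (suc N) 1≤p ∷ exponents-unique (p ∸ ℓ) p (suc N) 1≤p ∷ exponents-unique p p (suc N) 1≤p
      ∷ exponents-unique (p + 2 * ℓ) (2 * p) (suc N) 1≤2p ∷ exponents-unique (p ∸ 2 * ℓ) (2 * p) (suc N) 1≤2p ∷ [])
    ( (inClass-disjoint A₁-class A₂-class ℓ≢p∸ℓ ∷ inClass-disjoint A₁-class A₃-class (>⇒≢ 1≤ℓ)
        ∷ inClass-disjoint A₁-class B₁-class (<⇒≢ ℓ<2ℓ) ∷ inClass-disjoint A₁-class B₂-class ℓ≢p∸2ℓ ∷ [])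
    ∷ (inClass-disjoint A₂-class A₃-class (>⇒≢ (m<n⇒0<n∸m ℓ<p)) ∷ inClass-disjoint A₂-class B₁-class p∸ℓ≢2ℓ
        ∷ inClass-disjoint A₂-class B₂-class p∸ℓ≢p∸2ℓ ∷ [])
    ∷ (inClass-disjoint A₃-class B₁-class (<⇒≢ (<-≤-trans (s≤s z≤n) ℓ<2ℓ))
        ∷ inClass-disjoint A₃-class B₂-class (<⇒≢ (m<n⇒0<n∸m 2ℓ<p)) ∷ [])
    ∷ (inClass-disjoint B₁-class₂ B₂-class₂ p+2ℓ≢p∸2ℓ ∷ [])
    ∷ [] ∷ [])
    where
    1≤2p = <-trans 1≤p p<2p
    ℓ≢p∸ℓ : ℓ ≢ p ∸ ℓ
    ℓ≢p∸ℓ ℓ≡p∸ℓ =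
      <⇒≢ 2ℓ<p (trans (cong (ℓ +_) (+-identityʳ ℓ)) (trans (cong (_+ ℓ) ℓ≡p∸ℓ) (m∸n+n≡m (<⇒≤ ℓ<p))))
    ℓ≢p∸2ℓ : ℓ ≢ p ∸ 2 * ℓ
    ℓ≢p∸2ℓ ℓ≡p∸2ℓ = p≢3ℓ (trans (sym (m∸n+n≡m 2ℓ≤p)) (trans (cong (_+ 2 * ℓ) (sym ℓ≡p∸2ℓ)) refl))
    p∸ℓ≢2ℓ : p ∸ ℓ ≢ 2 * ℓ
    p∸ℓ≢2ℓ p∸ℓ≡2ℓ =
      p≢3ℓ (trans (sym (m∸n+n≡m (<⇒≤ ℓ<p))) (trans (cong (_+ ℓ) p∸ℓ≡2ℓ) (+-comm (2 * ℓ) ℓ)))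
    p∸ℓ≢p∸2ℓ : p ∸ ℓ ≢ p ∸ 2 * ℓ
    p∸ℓ≢p∸2ℓ eq = <⇒≢ ℓ<2ℓ (∸-cancelˡ-≡ (<⇒≤ ℓ<p) 2ℓ≤p eq)
    p+2ℓ≢p∸2ℓ : p + 2 * ℓ ≢ p ∸ 2 * ℓ
    p+2ℓ≢p∸2ℓ = >⇒≢ (≤-<-trans (m∸n≤m p (2 * ℓ)) (m<m+n p (<-≤-trans (s≤s z≤n) ℓ<2ℓ)))

  not-both-small : p ∸ 2 * ℓ ≤ 3 → ℓ ≤ 3 → ⊥
  not-both-small p∸2ℓ≤3 ℓ≤3 =
    <⇒≱ 10<p (subst (_≤ 10) (m∸n+n≡m 2ℓ≤p) (≤-trans (+-mono-≤ p∸2ℓ≤3 (*-monoʳ-≤ 2 ℓ≤3)) (n≤1+n 9)))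

  Spare : ℕ → Set
  Spare e = 1 ≤ e × e ≤ 3 × e ≢ ℓ × e ≢ p ∸ 2 * ℓ

  spare-∉ : ∀ {e} → Spare e → e ∉ concat families
  spare-∉ {e} (1≤e , e≤3 , e≢ℓ , e≢p∸2ℓ) = ∉-concat
    ( inClass-∉ A₁-class (small p e<p e≢ℓ)
    ∷ inClass-∉ A₂-class (small p e<p e≢p∸ℓ)
    ∷ inClass-∉ A₃-class (small p e<p (>⇒≢ 1≤e))
    ∷ inClass-∉ B₁-class₂ (small (2 * p) (<-trans e<p p<2p) (<⇒≢ (<-≤-trans e<p (m≤m+n p (2 * ℓ)))))
    ∷ inClass-∉ B₂-class (small p e<p e≢p∸2ℓ)
    ∷ [])
    where
    e<p : e < p
    e<p = ≤-<-trans e≤3 (≤-trans (s≤s (s≤s (s≤s (s≤s z≤n)))) (<⇒≤ 10<p))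
    small : ∀ M .{{_ : NonZero M}} {r} → e < M → e ≢ r → e % M ≢ r
    small M e<M e≢r e%M≡r = e≢r (trans (sym (m<n⇒m%n≡m e<M)) e%M≡r)
    e≢p∸ℓ : e ≢ p ∸ ℓ
    e≢p∸ℓ e≡p∸ℓ = not-both-small (≤-trans (∸-monoʳ-≤ p (<⇒≤ ℓ<2ℓ)) p∸ℓ≤3) (≤-trans (<⇒≤ ℓ<p∸ℓ) p∸ℓ≤3)
      where
      p∸ℓ≤3 = subst (_≤ 3) e≡p∸ℓ e≤3
      ℓ<p∸ℓ : ℓ < p ∸ ℓ
      ℓ<p∸ℓ = +-cancelʳ-< ℓ ℓ (p ∸ ℓ)
        (subst₂ _<_ (cong (ℓ +_) (+-identityʳ ℓ)) (sym (m∸n+n≡m (<⇒≤ ℓ<p))) 2ℓ<p)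

  numerator-≈ : quintuple ℓ p ≈[ N ] prod oneMinus (concat families) ⊛ one
  numerator-≈ = ≈-trans (quintuple-≈-prod 1≤ℓ 2ℓ<p) (≐⇒≈ N (≐-sym (≐-trans (⊛-identityʳ _) (≐-trans
    (prod-concat oneMinus families)
    (solve 5 (λ a b c d e → a ⊕ (b ⊕ (c ⊕ (d ⊕ (e ⊕ id)))) ⊜ (((a ⊕ b) ⊕ c) ⊕ d) ⊕ e) ≐-refl
       (prod oneMinus A₁) (prod oneMinus A₂) (prod oneMinus A₃) (prod oneMinus B₁) (prod oneMinus B₂))))))

  families-positive : All (1 ≤_) (concat families)
  families-positive = Allₚ.concat⁺
    ( exponents-positive ℓ p (suc N) 1≤ℓ ∷ exponents-positive (p ∸ ℓ) p (suc N) (m<n⇒0<n∸m ℓ<p)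
    ∷ exponents-positive p p (suc N) 1≤p ∷ exponents-positive (p + 2 * ℓ) (2 * p) (suc N) (≤-trans 1≤p (m≤m+n p _))
    ∷ exponents-positive (p ∸ 2 * ℓ) (2 * p) (suc N) (m<n⇒0<n∸m 2ℓ<p) ∷ [])

  coeff-positive-with-spares : ∀ ss → All Spare ss → Unique ss → 1ℤ ≤ℤ prod geom ss N →
    ∀ c → qPoch ⊛ c ≈[ N ] quintuple ℓ p → 0ℤ <ℤ c N
  coeff-positive-with-spares ss spares unique spares≥1 =
    quotient-coeff-positive N (concat families) ss families-positive (All.map proj₁ spares)
      (λ k → subst (_≤ 1) (multiplicity-++ (concat families) ss k) (multiplicity-unique all-unique k))
      numerator-≈ one-nonNeg₁ spares≥1
    where
    all-unique : Unique (concat families ++ ss)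
    all-unique = Uniqueₚ.++⁺ families-unique unique λ (v∈fs , v∈ss) → spare-∉ (lookup spares v∈ss) v∈fs

  spares-2-3 : ℓ ≡ 1 ⊎ p ∸ 2 * ℓ ≡ 1 → All Spare (2 ∷ 3 ∷ [])
  spares-2-3 ℓ≡1⊎p∸2ℓ≡1 = spare (s≤s (s≤s z≤n)) (s≤s (s≤s z≤n)) ∷ spare (s≤s (s≤s z≤n)) ≤-refl ∷ []
    where
    spare : ∀ {e} → 2 ≤ e → e ≤ 3 → Spare e
    spare {e} 2≤e e≤3 = <-trans (s≤s z≤n) 2≤e , e≤3 , e≢ℓ ℓ≡1⊎p∸2ℓ≡1 , e≢p∸2ℓ ℓ≡1⊎p∸2ℓ≡1
      where
      e≢ℓ : ℓ ≡ 1 ⊎ p ∸ 2 * ℓ ≡ 1 → e ≢ ℓ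
      e≢ℓ (inj₁ ℓ≡1)    e≡ℓ = >⇒≢ 2≤e (trans e≡ℓ ℓ≡1)
      e≢ℓ (inj₂ p∸2ℓ≡1) e≡ℓ = not-both-small (≤-trans (≤-reflexive p∸2ℓ≡1) (s≤s z≤n))
                                             (subst (_≤ 3) e≡ℓ e≤3)
      e≢p∸2ℓ : ℓ ≡ 1 ⊎ p ∸ 2 * ℓ ≡ 1 → e ≢ p ∸ 2 * ℓ
      e≢p∸2ℓ (inj₁ ℓ≡1)    e≡p∸2ℓ = not-both-small (subst (_≤ 3) e≡p∸2ℓ e≤3)
                                                    (≤-trans (≤-reflexive ℓ≡1) (s≤s z≤n))
      e≢p∸2ℓ (inj₂ p∸2ℓ≡1) e≡p∸2ℓ = >⇒≢ 2≤e (trans e≡p∸2ℓ p∸2ℓ≡1)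

  -- If neither ℓ nor p - 2ℓ is 1, the part 1 is free; otherwise the other one is
  -- large and the parts 2 and 3 are free.
  coeff-positive : 3 ≤ N → ∀ c → qPoch ⊛ c ≈[ N ] quintuple ℓ p → 0ℤ <ℤ c N
  coeff-positive 3≤N with ℓ ≟ 1 | p ∸ 2 * ℓ ≟ 1
  ... | no ℓ≢1  | no p∸2ℓ≢1 = coeff-positive-with-spares (1 ∷ [])
    ((≤-refl , s≤s z≤n , ≢-sym ℓ≢1 , ≢-sym p∸2ℓ≢1) ∷ []) ([] ∷ []) (geom-1-positive N)
  ... | yes ℓ≡1 | _          = coeff-positive-with-spares (2 ∷ 3 ∷ [])
    (spares-2-3 (inj₁ ℓ≡1)) (((λ ()) ∷ []) ∷ [] ∷ []) (geom-2-odd-positive 1 3≤N)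
  ... | no _    | yes p∸2ℓ≡1 = coeff-positive-with-spares (2 ∷ 3 ∷ [])
    (spares-2-3 (inj₂ p∸2ℓ≡1)) (((λ ()) ∷ []) ∷ [] ∷ []) (geom-2-odd-positive 1 3≤N)

module TripleCase {l N : ℕ} (3≤l : 3 ≤ l) (s≤N : suc (2 * l) ≤ N) where
  ℓ p s : ℕ
  ℓ = suc l
  p = 3 * ℓ
  s = suc (2 * l)
  open Exponents ℓ p N

  instance
    p-nonZero : NonZero p
    p-nonZero = _

  1≤l : 1 ≤ l
  1≤l = ≤-trans (s≤s z≤n) 3≤l

  b₁≥1 : ∀ j → 1 ≤ l + p * j
  b₁≥1 j = ≤-trans 1≤l (m≤m+n l (p * j))

  b₂≥1 : ∀ j → 1 ≤ p ∸ 1 + p * j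
  b₂≥1 j = ≤-trans 1≤l (≤-trans (m≤m+n l (2 * ℓ)) (m≤m+n (p ∸ 1) (p * j)))

  b₁s c₁s b₂s c₂s : List ℕ
  b₁s = exponents l p (suc N)
  c₁s = exponents 1 p (suc N)
  b₂s = exponents (p ∸ 1) p (suc N)
  c₂s = exponents (suc (2 * ℓ)) p (suc N)

  ratios₁ ratios₂ ratios : PS
  ratios₁ = prod (λ j → ratioFactor (l + p * j) (1 + p * j)) (downFrom (suc N))
  ratios₂ = prod (λ j → ratioFactor (p ∸ 1 + p * j) (suc (2 * ℓ) + p * j)) (downFrom (suc N))
  ratios  = ratios₁ ⊛ ratios₂

  ratios-nonNeg₁ : NonNeg₁ ratios
  ratios-nonNeg₁ = ⊛-nonNeg₁ (prod-nonNeg₁ (downFrom (suc N)) λ j → ratioFactor-nonNeg₁ (b₁≥1 j) (s≤s z≤n))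
                             (prod-nonNeg₁ (downFrom (suc N)) λ j → ratioFactor-nonNeg₁ (b₂≥1 j) (s≤s z≤n))

  numeratorFamilies : List (List ℕ)
  numeratorFamilies = A₁ ∷ A₂ ∷ A₃ ∷ b₁s ∷ c₁s ∷ b₂s ∷ c₂s ∷ []

  numerator-≈ : quintuple ℓ p ≈[ N ] prod oneMinus (concat numeratorFamilies) ⊛ ratios
  numerator-≈ = ≈-trans (quintuple-≈-prod (s≤s z≤n) (m<n+m (2 * ℓ) (s≤s z≤n))) (≐⇒≈ N (begin
    pA₁ ⊛ pA₂ ⊛ pA₃ ⊛ prod oneMinus B₁ ⊛ prod oneMinus B₂
      ≈⟨ ⊛-cong (⊛-congʳ (pA₁ ⊛ pA₂ ⊛ pA₃) (prod-oneMinus-split (suc N) split₂ b₂≥1 (λ _ → s≤s z≤n)))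
                (prod-oneMinus-split (suc N) split₁ b₁≥1 (λ _ → s≤s z≤n)) ⟩
    pA₁ ⊛ pA₂ ⊛ pA₃ ⊛ (ratios₂ ⊛ (pb₂ ⊛ pc₂)) ⊛ (ratios₁ ⊛ (pb₁ ⊛ pc₁))
      ≈⟨ solve 9 (λ a₁ a₂ a₃ r₁ b₁ c₁ r₂ b₂ c₂ →
           (((a₁ ⊕ a₂) ⊕ a₃) ⊕ (r₂ ⊕ (b₂ ⊕ c₂))) ⊕ (r₁ ⊕ (b₁ ⊕ c₁))
             ⊜ (a₁ ⊕ (a₂ ⊕ (a₃ ⊕ (b₁ ⊕ (c₁ ⊕ (b₂ ⊕ (c₂ ⊕ id))))))) ⊕ (r₁ ⊕ r₂))
           ≐-refl pA₁ pA₂ pA₃ ratios₁ pb₁ pc₁ ratios₂ pb₂ pc₂ ⟩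
    prod (prod oneMinus) numeratorFamilies ⊛ ratios
      ≈⟨ ⊛-congˡ ratios (prod-concat oneMinus numeratorFamilies) ⟨
    prod oneMinus (concat numeratorFamilies) ⊛ ratios ∎))
    where
    open ≐-Reasoning
    pA₁ pA₂ pA₃ pb₁ pc₁ pb₂ pc₂ : PS
    pA₁ = prod oneMinus A₁
    pA₂ = prod oneMinus A₂
    pA₃ = prod oneMinus A₃
    pb₁ = prod oneMinus b₁s
    pc₁ = prod oneMinus c₁s
    pb₂ = prod oneMinus b₂s
    pc₂ = prod oneMinus c₂s
    split₁ : ∀ j → (l + p * j) + (1 + p * j) ≡ (p ∸ 2 * ℓ) + 2 * p * j
    split₁ j = trans (identity l j) (cong (λ a → a + 2 * p * j) (sym (m+n∸n≡m ℓ (2 * ℓ))))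
      where
      identity : ∀ l j → (l + 3 * suc l * j) + (1 + 3 * suc l * j) ≡ suc l + 2 * (3 * suc l) * j
      identity = ℕ-Solver.solve-∀
    split₂ : ∀ j → (p ∸ 1 + p * j) + (suc (2 * ℓ) + p * j) ≡ (p + 2 * ℓ) + 2 * p * j
    split₂ j = identity l j
      where
      identity : ∀ l j → ((l + (suc l + (suc l + 0))) + 3 * suc l * j) + (suc (2 * suc l) + 3 * suc l * j)
                          ≡ (3 * suc l + 2 * suc l) + 2 * (3 * suc l) * j
      identity = ℕ-Solver.solve-∀

  spares : List ℕ
  spares = 2 ∷ s ∷ []

  sortedFamilies : List (List ℕ)
  sortedFamilies = b₂s ∷ c₂s ∷ A₂ ∷ (s ∷ []) ∷ A₁ ∷ b₁s ∷ (2 ∷ []) ∷ c₁s ∷ A₃ ∷ []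

  residues : List ℕ
  residues = p ∸ 1 ∷ suc (2 * ℓ) ∷ 2 * ℓ ∷ s ∷ ℓ ∷ l ∷ 2 ∷ 1 ∷ 0 ∷ []

  descending : Linked _>_ (p ∷ residues)
  descending = ∸-monoʳ-< (s≤s z≤n) (s≤s z≤n) ∷ +-monoˡ-≤ (2 * ℓ) (≤-trans (s≤s (s≤s z≤n)) 3≤l)
    ∷ ≤-refl ∷ subst (s <_) (sym (*-suc 2 l)) ≤-refl ∷ s≤s (m<m+n l (subst (1 ≤_) (sym (+-identityʳ l)) 1≤l))
    ∷ ≤-refl ∷ 3≤l ∷ s≤s (s≤s z≤n) ∷ s≤s z≤n ∷ [-]

  sortedFamilies-unique : Unique (concat sortedFamilies)
  sortedFamilies-unique with Linked⇒AllPairs (λ x>y y>z → <-trans y>z x>y) descending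
  ... | residues<p ∷ residues-distinct = Uniqueₚ.concat⁺
    (unique (p ∸ 1) ∷ unique (suc (2 * ℓ)) ∷ unique (p ∸ ℓ) ∷ ([] ∷ []) ∷ unique ℓ ∷ unique l ∷ ([] ∷ [])
      ∷ unique 1 ∷ unique p ∷ [])
    (inClasses-disjoint (classes residues<p) (AllPairs.map >⇒≢ residues-distinct))
    where
    unique : ∀ a → Unique (exponents a p (suc N))
    unique a = exponents-unique a p (suc N) (s≤s z≤n)
    class : ∀ a {r} → a % p ≡ r → InClass p r (exponents a p (suc N))
    class a = exponents-inClass a p (suc N) ∣-refl
    classes : All (_< p) residues → Pointwise (λ r xs → InClass p r xs) residues sortedFamilies
    classes (r₁ ∷ r₂ ∷ r₃ ∷ r₄ ∷ r₅ ∷ r₆ ∷ r₇ ∷ r₈ ∷ _ ∷ []) =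
      class (p ∸ 1) (m<n⇒m%n≡m r₁) ∷ class (suc (2 * ℓ)) (m<n⇒m%n≡m r₂)
      ∷ class (p ∸ ℓ) (trans (cong (_% p) (m+n∸m≡n ℓ (2 * ℓ))) (m<n⇒m%n≡m r₃))
      ∷ (m<n⇒m%n≡m r₄ ∷ []) ∷ class ℓ (m<n⇒m%n≡m r₅) ∷ class l (m<n⇒m%n≡m r₆) ∷ (m<n⇒m%n≡m r₇ ∷ [])
      ∷ class 1 (m<n⇒m%n≡m r₈) ∷ class p (n%n≡0 p) ∷ []

  multiplicities≤1 : ∀ k → multiplicity (concat numeratorFamilies) k + multiplicity spares k ≤ 1
  multiplicities≤1 k = subst (_≤ 1) (sym (begin
    multiplicity (concat numeratorFamilies) k + multiplicity spares k
      ≡⟨ cong (_+ multiplicity spares k) (multiplicity-concat numeratorFamilies k) ⟩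
    sum (map (λ xs → multiplicity xs k) numeratorFamilies) + multiplicity spares k
      ≡⟨ rearrange (m A₁) (m A₂) (m A₃) (m b₁s) (m c₁s) (m b₂s) (m c₂s) (indicator 2 k) (indicator s k) ⟩
    sum (map (λ xs → multiplicity xs k) sortedFamilies)
      ≡⟨ multiplicity-concat sortedFamilies k ⟨
    multiplicity (concat sortedFamilies) k ∎))
    (multiplicity-unique sortedFamilies-unique k)
    where
    open ≡-Reasoning
    m : List ℕ → ℕ
    m xs = multiplicity xs k
    rearrange : ∀ a₁ a₂ a₃ b₁ c₁ b₂ c₂ t u →
      (a₁ + (a₂ + (a₃ + (b₁ + (c₁ + (b₂ + (c₂ + 0))))))) + (t + (u + 0))
        ≡ b₂ + (c₂ + (a₂ + ((u + 0) + (a₁ + (b₁ + ((t + 0) + (c₁ + (a₃ + 0))))))))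
    rearrange = ℕ-Solver.solve-∀

  numerator-positive : All (1 ≤_) (concat numeratorFamilies)
  numerator-positive = Allₚ.concat⁺
    ( positive ℓ (s≤s z≤n) ∷ positive (p ∸ ℓ) (m<n⇒0<n∸m (m<m+n ℓ (s≤s z≤n))) ∷ positive p (s≤s z≤n)
    ∷ positive l 1≤l ∷ positive 1 ≤-refl ∷ positive (p ∸ 1) (≤-trans 1≤l (m≤m+n l (2 * ℓ)))
    ∷ positive (suc (2 * ℓ)) (s≤s z≤n) ∷ [])
    where
    positive : ∀ a → 1 ≤ a → All (1 ≤_) (exponents a p (suc N))
    positive a = exponents-positive a p (suc N)

  coeff-positive : ∀ c → qPoch ⊛ c ≈[ N ] quintuple ℓ p → 0ℤ <ℤ c N
  coeff-positive = quotient-coeff-positive N (concat numeratorFamilies) spares numerator-positive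
    (s≤s z≤n ∷ s≤s z≤n ∷ []) multiplicities≤1 numerator-≈ ratios-nonNeg₁ (geom-2-odd-positive l s≤N)

quintuple-quotient-positive : ∀ ℓ p N → 0 < ℓ → 10 < p → 2 * ℓ < p → 2 * ℓ < N →
  ∀ c → qPoch ⊛ c ≈[ N ] quintuple ℓ p → 0ℤ <ℤ c N
quintuple-quotient-positive ℓ@(suc l) p N 0<ℓ 10<p 2ℓ<p 2ℓ<N with p ≟ 3 * ℓ
... | no p≢3ℓ  = GenericCase.coeff-positive 0<ℓ 2ℓ<p 10<p p≢3ℓ N (<-≤-trans (s≤s (*-monoʳ-≤ 2 0<ℓ)) 2ℓ<N)
... | yes refl = TripleCase.coeff-positive 3≤l (≤-trans 2l<2ℓ (<⇒≤ 2ℓ<N))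
  where
  3≤l : 3 ≤ l
  3≤l = ≮⇒≥ λ l<3 → <⇒≱ 10<p (≤-trans (*-monoʳ-≤ 3 l<3) (n≤1+n 9))
  2l<2ℓ : 2 * l < 2 * ℓ
  2l<2ℓ = subst (suc (2 * l) ≤_) (sym (*-suc 2 l)) (n≤1+n _)

lemma3p4 : (ℓ : ℕ) → 0 < ℓ →
    ∃[ t₀ ] ((p : ℕ) → 10 < p → 2 * ℓ < p →
      (c : PS) → ((n : ℕ) → (qPoch ⊛ c) n ≡ quintuple ℓ p n) →
      (t : ℕ) → t₀ < t → 0ℤ <ℤ c t)
lemma3p4 ℓ 0<ℓ = 2 * ℓ , λ p 10<p 2ℓ<p c c-quotient t 2ℓ<t →
  quintuple-quotient-positive ℓ p t 0<ℓ 10<p 2ℓ<p 2ℓ<t c (mk≈ λ n _ → c-quotient n)
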